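{- For $|q|<1$, \[ \sum_{n=1}^{\infty}\frac{q^{n(n+1)/2}}{(1-q^n)(-q;q)_n}=\sum_{n=1}^{\infty}\frac{q^n}{1+q^n}. \] Hence, for every positive integer $n$, if $d_e(n)$ and $d_o(n)$ denote the numbers of even and odd divisors of $n$ respectively, \[ \sum_{\substack{\pi\in\mathcal{D}(n)\\ s(\pi)\ \text{odd}}}(-1)^{\mathrm{rank}(\pi)-1}=d_e(n)-d_o(n). \]
   Context: $(A;q)_n=\prod_{j=0}^{n-1}(1-Aq^j)$. For a partition $\pi$: $s(\pi)$ smallest part, $l(\pi)$ largest part, $\#(\pi)$ number of parts, $\mathrm{rank}(\pi)=l(\pi)-\#(\pi)$. $\mathcal{D}(n)$: partitions of $n$ into distinct parts. -}

module Defs where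

open import Data.Nat as ℕ using (ℕ; zero; suc; _<_; _≟_)
open import Data.Nat.Divisibility using (_∣_; _∣?_)
open import Data.Integer as ℤ using (ℤ; +_)
open import Data.List using (List; []; _∷_; map; upTo; foldr; filter; length)
open import Data.Nat.ListAction using (sum)
open import Data.List.Relation.Unary.All using (All)
open import Data.List.Relation.Unary.Linked using (Linked)
open import Data.Bool using (if_then_else_)
open import Relation.Nullary using (does; ¬_; ¬?)
open import Relation.Binary.PropositionalEquality using (_≡_)
open import Data.Product using (_×_)

-- Formal power series over ℤ in q, as coefficient functions.

PS : Set
PS = ℕ → ℤ

sumℤ : List ℤ → ℤ
sumℤ = foldr ℤ._+_ (+ 0)

Σ≤ : ℕ → (ℕ → ℤ) → ℤ
Σ≤ N f = sumℤ (map f (upTo (suc N)))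

_⊛_ : PS → PS → PS
(f ⊛ g) N = Σ≤ N (λ k → f k ℤ.* g (N ℕ.∸ k))

infixl 7 _⊛_

one : PS
one zero    = + 1
one (suc _) = + 0

-- q^m · f
shift : ℕ → PS → PS
shift m f N = if does (m ℕ.≤? N) then f (N ℕ.∸ m) else + 0

-- geom a m = 1/(1 - a q^m) = Σ_{k≥0} a^k q^{m k}   (for m ≥ 1;
-- the k-range 0..N suffices for coefficient N since m ≥ 1)
geom : ℤ → ℕ → PS
geom a m N = Σ≤ N (λ k → if does (m ℕ.* k ≟ N) then a ℤ.^ k else + 0)

-- 1/(-q;q)_n = Π_{j=1}^{n} 1/(1+q^j)
invNegQPoch : ℕ → PS
invNegQPoch zero    = one
invNegQPoch (suc n) = invNegQPoch n ⊛ geom (ℤ.- (+ 1)) (suc n)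

-- n-th summand of the left side: q^{n(n+1)/2} / ((1-q^n)(-q;q)_n)
lhsTerm : ℕ → PS
lhsTerm n = shift ((n ℕ.* suc n) ℕ./ 2) (geom (+ 1) n ⊛ invNegQPoch n)

-- n-th summand of the right side: q^n / (1+q^n)
rhsTerm : ℕ → PS
rhsTerm n = shift n (geom (ℤ.- (+ 1)) n)

-- Coefficient of q^N of Σ_{n≥1} term n.  The n-th summand has order ≥ n
-- on both sides, so only n = 1..N contribute to the coefficient of q^N.
seriesCoeff : (ℕ → PS) → PS
seriesCoeff t N = sumℤ (map (λ n → t (suc n) N) (upTo N))

-- Partitions into distinct parts: strictly decreasing lists of positive
-- naturals (largest part first).

IsDistinctPartition : ℕ → List ℕ → Set
IsDistinctPartition n π = Linked ℕ._>_ π × All (0 <_) π × sum π ≡ n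

-- largest part (head); 0 for the empty partition
largest : List ℕ → ℕ
largest []      = 0
largest (x ∷ _) = x

-- smallest part (last); 0 for the empty partition
smallest : List ℕ → ℕ
smallest []           = 0
smallest (x ∷ [])     = x
smallest (_ ∷ y ∷ ys) = smallest (y ∷ ys)

rank : List ℕ → ℤ
rank π = + largest π ℤ.- + length π

negOnePow : ℤ → ℤ
negOnePow z = if does (2 ∣? ℤ.∣ z ∣) then + 1 else ℤ.- (+ 1)

weight : List ℕ → ℤ
weight π = if does (2 ∣? smallest π) then + 0 else negOnePow (rank π ℤ.- + 1)

divisors : ℕ → List ℕ
divisors n = filter (_∣? n) (map suc (upTo n))

dₑ : ℕ → ℕ
dₑ n = length (filter (2 ∣?_) (divisors n))

dₒ : ℕ → ℕ
dₒ n = length (filter (λ d → ¬? (2 ∣? d)) (divisors n))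

module Submission where

-- Expanding 1/(1 - q^n) as Σ_j q^(n j) splits the left side into Σ_j A_j, where
-- A_j = Σ_n q^(T_(n+1) + (n+1) j) / (-q;q)_(n+1) and T_n = n(n+1)/2.  The identity
-- 1/(-q;q)_n = (1 + q^(n+1)) / (-q;q)_(n+1) gives A_j + A_(j+1) = q^(j+1) (1 + A_(j+1)).
-- Since A_j = O(q^(j+1)), this functional equation has only one solution; another one is
-- B_j = Σ_n (-1)^n q^(j+1+n) (q^(j+1);q)_n.  Summing B_j over j and using the telescoping sum
-- Σ_j q^j (q^(j+1);q)_n = 1/(1 - q^(n+1)) gives Σ_n (-1)^n q^(n+1)/(1 - q^(n+1)), which is the
-- right side with its double sum transposed.
--
-- For the partition identity, split the distinct partitions with all parts > j according to whether
-- j+1 is a part (necessarily the smallest one).  Then C_j = (-1)^j (Σ_π (-1)^rank(π) - 1) satisfies the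
-- same functional equation, so C_j = B_j; and the signed count over partitions with odd smallest part
-- telescopes, two values of j at a time, to -Σ_j C_j, whose q^n coefficient is d_e(n) - d_o(n).

open import Data.Bool using (true; false; if_then_else_)
open import Data.Empty using (⊥-elim)
open import Data.Product using (_×_; _,_; proj₁; proj₂; ∃-syntax)
open import Data.Sum using (_⊎_; inj₁; inj₂)
open import Function using (_∘_)
open import Function.Bundles using (_⇔_; mk⇔)
import Function.Properties.Equivalence as ⇔
open import Relation.Nullary using (Dec; yes; no; does; ¬_; ¬?)
open import Relation.Nullary.Decidable using (dec-true; dec-false)
open import Relation.Binary.PropositionalEquality

open import Data.Nat as ℕ using (ℕ; zero; suc; _+_; _*_; _∸_; _≤_; _<_; z≤n; s≤s; _≤?_; _≟_)
import Data.Nat.Properties as ℕ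
open import Data.Nat.Induction using (<-rec)
open import Data.Nat.Tactic.RingSolver using () renaming (solve-∀ to ℕ-solve-∀)
import Data.Nat.DivMod as DivMod
import Data.Nat.Divisibility as Div
open import Data.Nat.Divisibility using (_∣_; _∣?_)
open import Data.Nat.ListAction using (sum)
import Data.Nat.ListAction.Properties as ListActionP
open import Data.Integer as ℤ using (ℤ; +_; -[1+_]; _-_; 0ℤ; 1ℤ; -1ℤ)
  renaming (_+_ to _+ᶻ_; _*_ to _*ᶻ_; -_ to -ᶻ_)
import Data.Integer.Properties as ℤ
open import Data.Integer.Tactic.RingSolver using (solve-∀)

open import Data.List using (List; []; _∷_; _++_; map; applyUpTo; upTo; length; filter)
import Data.List.Properties as ListP
open import Data.List.Relation.Unary.All as All using (All; []; _∷_)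
import Data.List.Relation.Unary.All.Properties as AllP
open import Data.List.Relation.Unary.Any using (here)
open import Data.List.Relation.Unary.Linked as Linked using (Linked; []; [-]; _∷_)
import Data.List.Relation.Unary.Linked.Properties as LinkedP
open import Data.List.Relation.Unary.Unique.Propositional using (Unique; []; _∷_)
import Data.List.Relation.Unary.Unique.Propositional.Properties as UniqueP
open import Data.List.Membership.Propositional using (_∈_)
open import Data.List.Membership.Propositional.Properties using (∈-++⁺ˡ; ∈-++⁺ʳ; ∈-++⁻; ∈-map⁺; ∈-map⁻)
open import Data.List.Membership.Propositional.Properties.WithK using (unique∧set⇒bag)
open import Data.List.Relation.Binary.BagAndSetEquality using (∼bag⇒↭)
open import Data.List.Relation.Binary.Permutation.Propositional using (_↭_; ↭⇒↭ₛ′)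
open import Data.List.Relation.Binary.Permutation.Propositional.Properties using (map⁺)
open import Data.List.Relation.Binary.Permutation.Setoid.Properties ℤ.≡-setoid using (foldr-commMonoid)

open import Defs

Σ< : ℕ → (ℕ → ℤ) → ℤ
Σ< zero    f = 0ℤ
Σ< (suc n) f = f 0 +ᶻ Σ< n (f ∘ suc)

sumℤ-map-applyUpTo : ∀ n (f : ℕ → ℤ) (g : ℕ → ℕ) → sumℤ (map f (applyUpTo g n)) ≡ Σ< n (f ∘ g)
sumℤ-map-applyUpTo zero    f g = refl
sumℤ-map-applyUpTo (suc n) f g = cong (f (g 0) +ᶻ_) (sumℤ-map-applyUpTo n f (g ∘ suc))

Σ≤≡Σ< : ∀ N f → Σ≤ N f ≡ Σ< (suc N) f
Σ≤≡Σ< N f = sumℤ-map-applyUpTo (suc N) f (λ i → i)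

Σ<-cong : ∀ n {f g : ℕ → ℤ} → (∀ i → i < n → f i ≡ g i) → Σ< n f ≡ Σ< n g
Σ<-cong zero    eq = refl
Σ<-cong (suc n) eq = cong₂ _+ᶻ_ (eq 0 (s≤s z≤n)) (Σ<-cong n (λ i i<n → eq (suc i) (s≤s i<n)))

Σ<-ext : ∀ n {f g : ℕ → ℤ} → (∀ i → f i ≡ g i) → Σ< n f ≡ Σ< n g
Σ<-ext n eq = Σ<-cong n (λ i _ → eq i)

Σ<-zero : ∀ n {f : ℕ → ℤ} → (∀ i → i < n → f i ≡ 0ℤ) → Σ< n f ≡ 0ℤ
Σ<-zero zero    eq = refl
Σ<-zero (suc n) eq = cong₂ _+ᶻ_ (eq 0 (s≤s z≤n)) (Σ<-zero n (λ i i<n → eq (suc i) (s≤s i<n)))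

Σ<-+ : ∀ n (f g : ℕ → ℤ) → Σ< n (λ i → f i +ᶻ g i) ≡ Σ< n f +ᶻ Σ< n g
Σ<-+ zero    f g = refl
Σ<-+ (suc n) f g = trans (cong (f 0 +ᶻ g 0 +ᶻ_) (Σ<-+ n (f ∘ suc) (g ∘ suc))) (interchange (f 0) (g 0) _ _)
  where
  interchange : ∀ a b c d → a +ᶻ b +ᶻ (c +ᶻ d) ≡ a +ᶻ c +ᶻ (b +ᶻ d)
  interchange = solve-∀

Σ<-*ˡ : ∀ n c (f : ℕ → ℤ) → Σ< n (λ i → c *ᶻ f i) ≡ c *ᶻ Σ< n f
Σ<-*ˡ zero    c f = sym (ℤ.*-zeroʳ c)
Σ<-*ˡ (suc n) c f = trans (cong (c *ᶻ f 0 +ᶻ_) (Σ<-*ˡ n c (f ∘ suc))) (sym (ℤ.*-distribˡ-+ c (f 0) _))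

Σ<-neg : ∀ n (f : ℕ → ℤ) → Σ< n (λ i → -ᶻ f i) ≡ -ᶻ Σ< n f
Σ<-neg zero    f = refl
Σ<-neg (suc n) f = trans (cong (-ᶻ f 0 +ᶻ_) (Σ<-neg n (f ∘ suc))) (sym (ℤ.neg-distrib-+ (f 0) _))

Σ<-- : ∀ n (f g : ℕ → ℤ) → Σ< n (λ i → f i - g i) ≡ Σ< n f - Σ< n g
Σ<-- n f g = trans (Σ<-+ n f (λ i → -ᶻ g i)) (cong (Σ< n f +ᶻ_) (Σ<-neg n g))

Σ<-suc : ∀ n (f : ℕ → ℤ) → Σ< (suc n) f ≡ Σ< n f +ᶻ f n
Σ<-suc zero    f = trans (ℤ.+-identityʳ (f 0)) (sym (ℤ.+-identityˡ (f 0)))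
Σ<-suc (suc n) f = trans (cong (f 0 +ᶻ_) (Σ<-suc n (f ∘ suc))) (sym (ℤ.+-assoc (f 0) _ _))

Σ<-truncate : ∀ K R {f : ℕ → ℤ} → (∀ i → K ≤ i → f i ≡ 0ℤ) → K ≤ R → Σ< R f ≡ Σ< K f
Σ<-truncate K R {f} vanish K≤R with ℕ.m≤n⇒∃[o]m+o≡n K≤R
... | d , refl = extend d
  where
  extend : ∀ d → Σ< (K + d) f ≡ Σ< K f
  extend zero    = cong (λ n → Σ< n f) (ℕ.+-identityʳ K)
  extend (suc d) = begin
    Σ< (K + suc d) f          ≡⟨ cong (λ n → Σ< n f) (ℕ.+-suc K d) ⟩
    Σ< (suc (K + d)) f        ≡⟨ Σ<-suc (K + d) f ⟩
    Σ< (K + d) f +ᶻ f (K + d) ≡⟨ cong₂ _+ᶻ_ (extend d) (vanish (K + d) (ℕ.m≤m+n K d)) ⟩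
    Σ< K f +ᶻ 0ℤ              ≡⟨ ℤ.+-identityʳ (Σ< K f) ⟩
    Σ< K f                    ∎
    where open ≡-Reasoning

Σ<-swap : ∀ n m (f : ℕ → ℕ → ℤ) → Σ< n (λ i → Σ< m (f i)) ≡ Σ< m (λ j → Σ< n (λ i → f i j))
Σ<-swap zero    m f = sym (Σ<-zero m (λ _ _ → refl))
Σ<-swap (suc n) m f = trans (cong (Σ< m (f 0) +ᶻ_) (Σ<-swap n m (f ∘ suc)))
                            (sym (Σ<-+ m (f 0) (λ j → Σ< n (λ i → f (suc i) j))))

Σ<-single : ∀ n k {f : ℕ → ℤ} → k < n → (∀ i → i < n → i ≢ k → f i ≡ 0ℤ) → Σ< n f ≡ f k
Σ<-single zero    k ()
Σ<-single (suc n) k {f} k<1+n others with k ≟ n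
... | yes refl = begin
  Σ< (suc k) f     ≡⟨ Σ<-suc k f ⟩
  Σ< k f +ᶻ f k    ≡⟨ cong (_+ᶻ f k) (Σ<-zero k (λ i i<k → others i (ℕ.m≤n⇒m≤1+n i<k) (ℕ.<⇒≢ i<k))) ⟩
  0ℤ +ᶻ f k        ≡⟨ ℤ.+-identityˡ (f k) ⟩
  f k              ∎
  where open ≡-Reasoning
... | no k≢n = begin
  Σ< (suc n) f     ≡⟨ Σ<-suc n f ⟩
  Σ< n f +ᶻ f n    ≡⟨ cong₂ _+ᶻ_ (Σ<-single n k k<n (λ i i<n → others i (ℕ.m≤n⇒m≤1+n i<n)))
                                 (others n ℕ.≤-refl (k≢n ∘ sym)) ⟩
  f k +ᶻ 0ℤ        ≡⟨ ℤ.+-identityʳ (f k) ⟩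
  f k              ∎
  where
  open ≡-Reasoning
  k<n : k < n
  k<n = ℕ.≤∧≢⇒< (ℕ.≤-pred k<1+n) k≢n

Σ<-reverse : ∀ n (f : ℕ → ℤ) → Σ< n f ≡ Σ< n (λ k → f (n ∸ suc k))
Σ<-reverse zero    f = refl
Σ<-reverse (suc n) f = begin
  Σ< (suc n) f                         ≡⟨ Σ<-suc n f ⟩
  Σ< n f +ᶻ f n                        ≡⟨ cong (_+ᶻ f n) (Σ<-reverse n f) ⟩
  Σ< n (λ k → f (n ∸ suc k)) +ᶻ f n    ≡⟨ ℤ.+-comm _ (f n) ⟩
  f n +ᶻ Σ< n (λ k → f (n ∸ suc k))    ∎
  where open ≡-Reasoning

telescope : ∀ n (F : ℕ → ℤ) → Σ< n (λ j → F (suc j) - F j) ≡ F n - F 0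
telescope zero    F = sym (ℤ.+-inverseʳ (F 0))
telescope (suc n) F = begin
  Σ< (suc n) (λ j → F (suc j) - F j)                ≡⟨ Σ<-suc n (λ j → F (suc j) - F j) ⟩
  Σ< n (λ j → F (suc j) - F j) +ᶻ (F (suc n) - F n) ≡⟨ cong (_+ᶻ (F (suc n) - F n)) (telescope n F) ⟩
  F n - F 0 +ᶻ (F (suc n) - F n)                    ≡⟨ collapse (F (suc n)) (F n) (F 0) ⟩
  F (suc n) - F 0                                   ∎
  where
  open ≡-Reasoning
  collapse : ∀ a b c → b - c +ᶻ (a - b) ≡ a - c
  collapse = solve-∀

telescope-pairs : ∀ n (g a : ℕ → ℤ) → (∀ t → g (2 * t) - g (2 + 2 * t) ≡ a (2 * t) +ᶻ a (suc (2 * t)))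
  → g 0 - g (2 * n) ≡ Σ< (2 * n) a
telescope-pairs zero    g a step = ℤ.+-inverseʳ (g 0)
telescope-pairs (suc n) g a step = begin
  g 0 - g (2 * suc n)                                   ≡⟨ cong (λ k → g 0 - g k) (ℕ.*-suc 2 n) ⟩
  g 0 - g (2 + 2 * n)                                   ≡⟨ split (g 0) (g (2 * n)) (g (2 + 2 * n)) ⟩
  (g 0 - g (2 * n)) +ᶻ (g (2 * n) - g (2 + 2 * n))      ≡⟨ cong₂ _+ᶻ_ (telescope-pairs n g a step) (step n) ⟩
  Σ< (2 * n) a +ᶻ (a (2 * n) +ᶻ a (suc (2 * n)))        ≡⟨ sym (ℤ.+-assoc (Σ< (2 * n) a) (a (2 * n)) (a (suc (2 * n)))) ⟩
  Σ< (2 * n) a +ᶻ a (2 * n) +ᶻ a (suc (2 * n))          ≡⟨ cong (_+ᶻ a (suc (2 * n))) (sym (Σ<-suc (2 * n) a)) ⟩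
  Σ< (suc (2 * n)) a +ᶻ a (suc (2 * n))                 ≡⟨ sym (Σ<-suc (suc (2 * n)) a) ⟩
  Σ< (2 + 2 * n) a                                      ≡⟨ cong (λ k → Σ< k a) (sym (ℕ.*-suc 2 n)) ⟩
  Σ< (2 * suc n) a                                      ∎
  where
  open ≡-Reasoning
  split : ∀ x y z → x - z ≡ (x - y) +ᶻ (y - z)
  split = solve-∀

if-yes : ∀ {P A : Set} (d : Dec P) {x y : A} → P → (if does d then x else y) ≡ x
if-yes d p rewrite dec-true d p = refl

if-no : ∀ {P A : Set} (d : Dec P) {x y : A} → ¬ P → (if does d then x else y) ≡ y
if-no d ¬p rewrite dec-false d ¬p = refl

when : {P : Set} → Dec P → ℤ → ℤ
when d x = if does d then x else 0ℤ

when-cong : ∀ {P Q : Set} (d : Dec P) (e : Dec Q) {x y : ℤ} → (P → Q) → (Q → P) → (P → x ≡ y) → when d x ≡ when e y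
when-cong (yes p) (yes q) _   _   eq = eq p
when-cong (yes p) (no ¬q) p→q _   _  = ⊥-elim (¬q (p→q p))
when-cong (no ¬p) (yes q) _   q→p _  = ⊥-elim (¬p (q→p q))
when-cong (no ¬p) (no ¬q) _   _   _  = refl

shift-< : ∀ m (f : PS) {N} → N < m → shift m f N ≡ 0ℤ
shift-< m f {N} N<m = if-no (m ≤? N) (ℕ.<⇒≱ N<m)

shift-≥ : ∀ m (f : PS) {N} → m ≤ N → shift m f N ≡ f (N ∸ m)
shift-≥ m f {N} m≤N = if-yes (m ≤? N) m≤N

shift-+ : ∀ m (f : PS) k → shift m f (m + k) ≡ f k
shift-+ m f k = trans (shift-≥ m f (ℕ.m≤m+n m k)) (cong f (ℕ.m+n∸m≡n m k))

shift-cong : ∀ m (f g : PS) N → (m ≤ N → f (N ∸ m) ≡ g (N ∸ m)) → shift m f N ≡ shift m g N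
shift-cong m f g N eq with m ≤? N
... | yes m≤N = trans (shift-≥ m f m≤N) (trans (eq m≤N) (sym (shift-≥ m g m≤N)))
... | no  m≰N = trans (shift-< m f (ℕ.≰⇒> m≰N)) (sym (shift-< m g (ℕ.≰⇒> m≰N)))

shift-shift : ∀ a b (f : PS) N → shift a (shift b f) N ≡ shift (a + b) f N
shift-shift a b f N with a ≤? N
... | no a≰N = trans (shift-< a (shift b f) (ℕ.≰⇒> a≰N))
                     (sym (shift-< (a + b) f (ℕ.<-≤-trans (ℕ.≰⇒> a≰N) (ℕ.m≤m+n a b))))
... | yes a≤N with b ≤? N ∸ a
...   | yes b≤N∸a = begin
  shift a (shift b f) N  ≡⟨ shift-≥ a (shift b f) a≤N ⟩
  shift b f (N ∸ a)      ≡⟨ shift-≥ b f b≤N∸a ⟩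
  f (N ∸ a ∸ b)          ≡⟨ cong f (ℕ.∸-+-assoc N a b) ⟩
  f (N ∸ (a + b))        ≡⟨ sym (shift-≥ (a + b) f a+b≤N) ⟩
  shift (a + b) f N      ∎
  where
  open ≡-Reasoning
  a+b≤N : a + b ≤ N
  a+b≤N = subst (a + b ≤_) (ℕ.m+[n∸m]≡n a≤N) (ℕ.+-monoʳ-≤ a b≤N∸a)
...   | no b≰N∸a = trans (shift-≥ a (shift b f) a≤N)
                          (trans (shift-< b f (ℕ.≰⇒> b≰N∸a)) (sym (shift-< (a + b) f N<a+b)))
  where
  N<a+b : N < a + b
  N<a+b = subst (_< a + b) (ℕ.m+[n∸m]≡n a≤N) (ℕ.+-monoʳ-< a (ℕ.≰⇒> b≰N∸a))

shift-∸ : ∀ a c (f : PS) {N} → a ≤ N → shift c f (N ∸ a) ≡ shift (a + c) f N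
shift-∸ a c f {N} a≤N = trans (sym (shift-≥ a (shift c f) a≤N)) (shift-shift a c f N)

shift-+ᶻ : ∀ m (f g : PS) N → shift m (λ M → f M +ᶻ g M) N ≡ shift m f N +ᶻ shift m g N
shift-+ᶻ m f g N with m ℕ.≤ᵇ N
... | true  = refl
... | false = refl

shift-- : ∀ m (f g : PS) N → shift m (λ M → f M - g M) N ≡ shift m f N - shift m g N
shift-- m f g N with m ℕ.≤ᵇ N
... | true  = refl
... | false = refl

shift-*ˡ : ∀ m c (f : PS) N → shift m (λ M → c *ᶻ f M) N ≡ c *ᶻ shift m f N
shift-*ˡ m c f N with m ℕ.≤ᵇ N
... | true  = refl
... | false = sym (ℤ.*-zeroʳ c)

shift-Σ< : ∀ m n (F : ℕ → PS) N → shift m (λ M → Σ< n (λ i → F i M)) N ≡ Σ< n (λ i → shift m (F i) N)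
shift-Σ< m n F N with m ℕ.≤ᵇ N
... | true  = refl
... | false = sym (Σ<-zero n (λ _ _ → refl))

one-≢0 : ∀ {M} → M ≢ 0 → one M ≡ 0ℤ
one-≢0 {zero}  M≢0 = ⊥-elim (M≢0 refl)
one-≢0 {suc M} _   = refl

⊛-unfold : ∀ (f g : PS) N → (f ⊛ g) N ≡ Σ< (suc N) (λ k → f k *ᶻ g (N ∸ k))
⊛-unfold f g N = Σ≤≡Σ< N (λ k → f k *ᶻ g (N ∸ k))

⊛-congʳ : ∀ (f : PS) {g h : PS} → (∀ M → g M ≡ h M) → ∀ N → (f ⊛ g) N ≡ (f ⊛ h) N
⊛-congʳ f {g} {h} eq N = begin
  (f ⊛ g) N                                 ≡⟨ ⊛-unfold f g N ⟩
  Σ< (suc N) (λ k → f k *ᶻ g (N ∸ k))       ≡⟨ Σ<-ext (suc N) (λ k → cong (f k *ᶻ_) (eq (N ∸ k))) ⟩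
  Σ< (suc N) (λ k → f k *ᶻ h (N ∸ k))       ≡⟨ sym (⊛-unfold f h N) ⟩
  (f ⊛ h) N                                 ∎
  where open ≡-Reasoning

⊛-distribˡ-+ : ∀ (f g h : PS) N → (f ⊛ (λ M → g M +ᶻ h M)) N ≡ (f ⊛ g) N +ᶻ (f ⊛ h) N
⊛-distribˡ-+ f g h N = begin
  (f ⊛ (λ M → g M +ᶻ h M)) N                                             ≡⟨ ⊛-unfold f (λ M → g M +ᶻ h M) N ⟩
  Σ< (suc N) (λ k → f k *ᶻ (g (N ∸ k) +ᶻ h (N ∸ k)))                     ≡⟨ Σ<-ext (suc N) (λ k → ℤ.*-distribˡ-+ (f k) (g (N ∸ k)) (h (N ∸ k))) ⟩
  Σ< (suc N) (λ k → f k *ᶻ g (N ∸ k) +ᶻ f k *ᶻ h (N ∸ k))                ≡⟨ Σ<-+ (suc N) (λ k → f k *ᶻ g (N ∸ k)) (λ k → f k *ᶻ h (N ∸ k)) ⟩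
  Σ< (suc N) (λ k → f k *ᶻ g (N ∸ k)) +ᶻ Σ< (suc N) (λ k → f k *ᶻ h (N ∸ k)) ≡⟨ sym (cong₂ _+ᶻ_ (⊛-unfold f g N) (⊛-unfold f h N)) ⟩
  (f ⊛ g) N +ᶻ (f ⊛ h) N                                                 ∎
  where open ≡-Reasoning

⊛-identityʳ : ∀ (f : PS) N → (f ⊛ one) N ≡ f N
⊛-identityʳ f N = begin
  (f ⊛ one) N                               ≡⟨ ⊛-unfold f one N ⟩
  Σ< (suc N) (λ k → f k *ᶻ one (N ∸ k))     ≡⟨ Σ<-single (suc N) N ℕ.≤-refl off-diagonal ⟩
  f N *ᶻ one (N ∸ N)                        ≡⟨ cong (λ M → f N *ᶻ one M) (ℕ.n∸n≡0 N) ⟩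
  f N *ᶻ 1ℤ                                 ≡⟨ ℤ.*-identityʳ (f N) ⟩
  f N                                       ∎
  where
  open ≡-Reasoning
  off-diagonal : ∀ k → k < suc N → k ≢ N → f k *ᶻ one (N ∸ k) ≡ 0ℤ
  off-diagonal k k<1+N k≢N = trans (cong (f k *ᶻ_) (one-≢0 N∸k≢0)) (ℤ.*-zeroʳ (f k))
    where
    N∸k≢0 : N ∸ k ≢ 0
    N∸k≢0 e = k≢N (ℕ.≤-antisym (ℕ.≤-pred k<1+N) (ℕ.m∸n≡0⇒m≤n e))

⊛-*ʳ : ∀ (f : PS) c (g : PS) N → (f ⊛ (λ M → c *ᶻ g M)) N ≡ c *ᶻ (f ⊛ g) N
⊛-*ʳ f c g N = begin
  (f ⊛ (λ M → c *ᶻ g M)) N                    ≡⟨ ⊛-unfold f (λ M → c *ᶻ g M) N ⟩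
  Σ< (suc N) (λ k → f k *ᶻ (c *ᶻ g (N ∸ k)))  ≡⟨ Σ<-ext (suc N) (λ k → pull (f k) c (g (N ∸ k))) ⟩
  Σ< (suc N) (λ k → c *ᶻ (f k *ᶻ g (N ∸ k)))  ≡⟨ Σ<-*ˡ (suc N) c (λ k → f k *ᶻ g (N ∸ k)) ⟩
  c *ᶻ Σ< (suc N) (λ k → f k *ᶻ g (N ∸ k))    ≡⟨ cong (c *ᶻ_) (sym (⊛-unfold f g N)) ⟩
  c *ᶻ (f ⊛ g) N                              ∎
  where
  open ≡-Reasoning
  pull : ∀ x c y → x *ᶻ (c *ᶻ y) ≡ c *ᶻ (x *ᶻ y)
  pull = solve-∀

⊛-shiftʳ : ∀ (f : PS) m (g : PS) N → (f ⊛ shift (suc m) g) N ≡ shift (suc m) (f ⊛ g) N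
⊛-shiftʳ f m g N with suc m ≤? N
... | no m≰N = trans (⊛-unfold f (shift (suc m) g) N)
                 (trans (Σ<-zero (suc N) (λ k _ → trans (cong (f k *ᶻ_) (shift-< (suc m) g (ℕ.≤-<-trans (ℕ.m∸n≤m N k) (ℕ.≰⇒> m≰N))))
                                                         (ℤ.*-zeroʳ (f k))))
                        (sym (shift-< (suc m) (f ⊛ g) (ℕ.≰⇒> m≰N))))
... | yes m≤N with ℕ.m≤n⇒∃[o]m+o≡n m≤N
...   | N′ , refl = begin
  (f ⊛ shift (suc m) g) (suc m + N′)                                ≡⟨ ⊛-unfold f (shift (suc m) g) (suc m + N′) ⟩
  Σ< (suc (suc m + N′)) (λ k → f k *ᶻ shift (suc m) g (suc m + N′ ∸ k)) ≡⟨ Σ<-truncate (suc N′) (suc (suc m + N′)) beyond (s≤s (ℕ.m≤n+m N′ (suc m))) ⟩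
  Σ< (suc N′) (λ k → f k *ᶻ shift (suc m) g (suc m + N′ ∸ k))       ≡⟨ Σ<-cong (suc N′) within ⟩
  Σ< (suc N′) (λ k → f k *ᶻ g (N′ ∸ k))                             ≡⟨ sym (⊛-unfold f g N′) ⟩
  (f ⊛ g) N′                                                        ≡⟨ sym (shift-+ (suc m) (f ⊛ g) N′) ⟩
  shift (suc m) (f ⊛ g) (suc m + N′)                                ∎
  where
  open ≡-Reasoning
  beyond : ∀ k → suc N′ ≤ k → f k *ᶻ shift (suc m) g (suc m + N′ ∸ k) ≡ 0ℤ
  beyond k N′<k = trans (cong (f k *ᶻ_) (shift-< (suc m) g small)) (ℤ.*-zeroʳ (f k))
    where
    small : suc m + N′ ∸ k < suc m
    small = ℕ.≤-<-trans (ℕ.∸-monoʳ-≤ (suc m + N′) N′<k) (ℕ.≤-reflexive (cong suc (ℕ.m+n∸n≡m m N′)))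
  within : ∀ k → k < suc N′ → f k *ᶻ shift (suc m) g (suc m + N′ ∸ k) ≡ f k *ᶻ g (N′ ∸ k)
  within k k<1+N′ = cong (f k *ᶻ_) (trans (cong (shift (suc m) g) (ℕ.+-∸-assoc (suc m) (ℕ.≤-pred k<1+N′)))
                                          (shift-+ (suc m) g (N′ ∸ k)))

⊛-comm : ∀ (f g : PS) N → (f ⊛ g) N ≡ (g ⊛ f) N
⊛-comm f g N = begin
  (f ⊛ g) N                                           ≡⟨ ⊛-unfold f g N ⟩
  Σ< (suc N) (λ k → f k *ᶻ g (N ∸ k))                 ≡⟨ Σ<-reverse (suc N) (λ k → f k *ᶻ g (N ∸ k)) ⟩
  Σ< (suc N) (λ k → f (N ∸ k) *ᶻ g (N ∸ (N ∸ k)))     ≡⟨ Σ<-cong (suc N) swap ⟩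
  Σ< (suc N) (λ k → g k *ᶻ f (N ∸ k))                 ≡⟨ sym (⊛-unfold g f N) ⟩
  (g ⊛ f) N                                           ∎
  where
  open ≡-Reasoning
  swap : ∀ k → k < suc N → f (N ∸ k) *ᶻ g (N ∸ (N ∸ k)) ≡ g k *ᶻ f (N ∸ k)
  swap k k<1+N = trans (cong (λ i → f (N ∸ k) *ᶻ g i) (ℕ.m∸[m∸n]≡n (ℕ.≤-pred k<1+N))) (ℤ.*-comm (f (N ∸ k)) (g k))

Recurrence : PS → ℤ → ℕ → PS → Set
Recurrence f a m h = ∀ N → h N ≡ f N +ᶻ shift m (λ M → a *ᶻ h M) N

recurrence-unique : ∀ {f a m g h} → Recurrence f a (suc m) g → Recurrence f a (suc m) h → ∀ N → g N ≡ h N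
recurrence-unique {f} {a} {m} {g} {h} rec-g rec-h = <-rec (λ N → g N ≡ h N) step
  where
  step : ∀ N → (∀ {M} → M < N → g M ≡ h M) → g N ≡ h N
  step N ih = begin
    g N                                         ≡⟨ rec-g N ⟩
    f N +ᶻ shift (suc m) (λ M → a *ᶻ g M) N     ≡⟨ cong (f N +ᶻ_) (shift-cong (suc m) (λ M → a *ᶻ g M) (λ M → a *ᶻ h M) N
                                                      (λ m<N → cong (a *ᶻ_) (ih (below m<N)))) ⟩
    f N +ᶻ shift (suc m) (λ M → a *ᶻ h M) N     ≡⟨ sym (rec-h N) ⟩
    h N                                         ∎
    where
    open ≡-Reasoning
    below : suc m ≤ N → N ∸ suc m < N
    below m<N = ℕ.∸-monoʳ-< (s≤s z≤n) m<N

geom-recurrence : ∀ a m → Recurrence one a (suc m) (geom a (suc m))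
geom-recurrence a m N = begin
  geom a (suc m) N                                     ≡⟨ Σ≤≡Σ< N (term N) ⟩
  term N 0 +ᶻ Σ< N (term N ∘ suc)                      ≡⟨ cong₂ _+ᶻ_ (constant N) (higher N) ⟩
  one N +ᶻ shift (suc m) (λ M → a *ᶻ geom a (suc m) M) N ∎
  where
  open ≡-Reasoning
  term : ℕ → ℕ → ℤ
  term N k = when (suc m * k ≟ N) (a ℤ.^ k)
  constant : ∀ N → term N 0 ≡ one N
  constant zero    = if-yes (suc m * 0 ≟ 0) (ℕ.*-zeroʳ (suc m))
  constant (suc N) = if-no (suc m * 0 ≟ suc N) (λ e → ℕ.0≢1+n (trans (sym (ℕ.*-zeroʳ (suc m))) e))
  higher : ∀ N → Σ< N (term N ∘ suc) ≡ shift (suc m) (λ M → a *ᶻ geom a (suc m) M) N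
  higher N with suc m ≤? N
  ... | no m≰N = trans (Σ<-zero N (λ k _ → if-no (suc m * suc k ≟ N) (λ e → m≰N (subst (suc m ≤_) e (ℕ.m≤m*n (suc m) (suc k))))))
                       (sym (shift-< (suc m) (λ M → a *ᶻ geom a (suc m) M) (ℕ.≰⇒> m≰N)))
  ... | yes m≤N with ℕ.m≤n⇒∃[o]m+o≡n m≤N
  ...   | N′ , refl = begin
    Σ< (suc m + N′) (term (suc m + N′) ∘ suc)      ≡⟨ Σ<-ext (suc m + N′) factor ⟩
    Σ< (suc m + N′) (λ k → a *ᶻ term N′ k)         ≡⟨ Σ<-truncate (suc N′) (suc m + N′) beyond (s≤s (ℕ.m≤n+m N′ m)) ⟩
    Σ< (suc N′) (λ k → a *ᶻ term N′ k)             ≡⟨ Σ<-*ˡ (suc N′) a (term N′) ⟩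
    a *ᶻ Σ< (suc N′) (term N′)                     ≡⟨ cong (a *ᶻ_) (sym (Σ≤≡Σ< N′ (term N′))) ⟩
    a *ᶻ geom a (suc m) N′                         ≡⟨ sym (shift-+ (suc m) (λ M → a *ᶻ geom a (suc m) M) N′) ⟩
    shift (suc m) (λ M → a *ᶻ geom a (suc m) M) (suc m + N′) ∎
    where
    factor : ∀ k → term (suc m + N′) (suc k) ≡ a *ᶻ term N′ k
    factor k with suc m * k ≟ N′
    ... | yes e = trans (if-yes (suc m * suc k ≟ suc m + N′) (trans (ℕ.*-suc (suc m) k) (cong (λ i → suc m + i) e)))
                        (sym (cong (a *ᶻ_) (if-yes (suc m * k ≟ N′) e)))
    ... | no ¬e = trans (if-no (suc m * suc k ≟ suc m + N′) (λ e → ¬e (ℕ.+-cancelˡ-≡ (suc m) _ _ (trans (sym (ℕ.*-suc (suc m) k)) e))))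
                        (sym (trans (cong (a *ᶻ_) (if-no (suc m * k ≟ N′) ¬e)) (ℤ.*-zeroʳ a)))
    beyond : ∀ k → suc N′ ≤ k → a *ᶻ term N′ k ≡ 0ℤ
    beyond k N′<k = trans (cong (a *ᶻ_) (if-no (suc m * k ≟ N′) (λ e → ℕ.<⇒≱ N′<k (subst (k ≤_) e (ℕ.m≤n*m k (suc m))))))
                          (ℤ.*-zeroʳ a)

recurrence-⊛ʳ : ∀ {a m g} (f : PS) → Recurrence one a (suc m) g → Recurrence f a (suc m) (f ⊛ g)
recurrence-⊛ʳ {a} {m} {g} f rec N = begin
  (f ⊛ g) N                                                  ≡⟨ ⊛-congʳ f rec N ⟩
  (f ⊛ (λ M → one M +ᶻ shift (suc m) ag M)) N               ≡⟨ ⊛-distribˡ-+ f one (shift (suc m) ag) N ⟩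
  (f ⊛ one) N +ᶻ (f ⊛ shift (suc m) ag) N                    ≡⟨ cong₂ _+ᶻ_ (⊛-identityʳ f N) (⊛-shiftʳ f m ag N) ⟩
  f N +ᶻ shift (suc m) (f ⊛ ag) N                            ≡⟨ cong (f N +ᶻ_) (shift-cong (suc m) (f ⊛ ag) (λ M → a *ᶻ (f ⊛ g) M) N (λ _ → ⊛-*ʳ f a g (N ∸ suc m))) ⟩
  f N +ᶻ shift (suc m) (λ M → a *ᶻ (f ⊛ g) M) N              ∎
  where
  open ≡-Reasoning
  ag : PS
  ag K = a *ᶻ g K

recurrence-⊛ˡ : ∀ {a m g} (f : PS) → Recurrence one a (suc m) g → Recurrence f a (suc m) (g ⊛ f)
recurrence-⊛ˡ {a} {m} {g} f rec N = begin
  (g ⊛ f) N                                         ≡⟨ ⊛-comm g f N ⟩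
  (f ⊛ g) N                                         ≡⟨ recurrence-⊛ʳ {a} {m} {g} f rec N ⟩
  f N +ᶻ shift (suc m) (λ M → a *ᶻ (f ⊛ g) M) N     ≡⟨ cong (f N +ᶻ_) (shift-cong (suc m) (λ M → a *ᶻ (f ⊛ g) M) (λ M → a *ᶻ (g ⊛ f) M) N (λ _ → cong (a *ᶻ_) (⊛-comm f g (N ∸ suc m)))) ⟩
  f N +ᶻ shift (suc m) (λ M → a *ᶻ (g ⊛ f) M) N     ∎
  where open ≡-Reasoning

recurrence-expand : ∀ {f m h} → Recurrence f 1ℤ (suc m) h → ∀ R M → M < R → h M ≡ Σ< R (λ j → shift (suc m * j) f M)
recurrence-expand {f} {m} {h} rec (suc R) M M<1+R = begin
  h M                                                            ≡⟨ rec M ⟩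
  f M +ᶻ shift (suc m) (λ K → 1ℤ *ᶻ h K) M                       ≡⟨ cong₂ _+ᶻ_ (cong (λ i → shift i f M) (sym (ℕ.*-zeroʳ (suc m)))) tail ⟩
  shift (suc m * 0) f M +ᶻ Σ< R (λ j → shift (suc m * suc j) f M) ∎
  where
  open ≡-Reasoning
  tail : shift (suc m) (λ K → 1ℤ *ᶻ h K) M ≡ Σ< R (λ j → shift (suc m * suc j) f M)
  tail with suc m ≤? M
  ... | no m≰M = trans (shift-< (suc m) (λ K → 1ℤ *ᶻ h K) (ℕ.≰⇒> m≰M))
                       (sym (Σ<-zero R (λ j _ → shift-< (suc m * suc j) f (ℕ.<-≤-trans (ℕ.≰⇒> m≰M) (ℕ.m≤m*n (suc m) (suc j))))))
  ... | yes m≤M = begin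
    shift (suc m) (λ K → 1ℤ *ᶻ h K) M                      ≡⟨ shift-≥ (suc m) (λ K → 1ℤ *ᶻ h K) m≤M ⟩
    1ℤ *ᶻ h (M ∸ suc m)                                    ≡⟨ ℤ.*-identityˡ (h (M ∸ suc m)) ⟩
    h (M ∸ suc m)                                          ≡⟨ recurrence-expand {f} rec R (M ∸ suc m) (ℕ.<-≤-trans (ℕ.∸-monoʳ-< (s≤s z≤n) m≤M) (ℕ.≤-pred M<1+R)) ⟩
    Σ< R (λ j → shift (suc m * j) f (M ∸ suc m))           ≡⟨ Σ<-ext R (λ j → trans (shift-∸ (suc m) (suc m * j) f m≤M)
                                                                                    (cong (λ i → shift i f M) (sym (ℕ.*-suc (suc m) j)))) ⟩
    Σ< R (λ j → shift (suc m * suc j) f M)                 ∎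

FunctionalEquation : (ℕ → PS) → Set
FunctionalEquation u = ∀ j N → u j N +ᶻ u (suc j) N ≡ shift (suc j) (λ M → one M +ᶻ u (suc j) M) N

Vanishing : (ℕ → PS) → Set
Vanishing u = ∀ j N → N ≤ j → u j N ≡ 0ℤ

functionalEquation-unique : ∀ {u v} → FunctionalEquation u → Vanishing u → FunctionalEquation v → Vanishing v
  → ∀ j N → u j N ≡ v j N
-- Strong induction on N and, for fixed N, downward induction on j starting where both sides vanish.
functionalEquation-unique {u} {v} fe-u van-u fe-v van-v j N = <-rec (λ N → ∀ j → u j N ≡ v j N) step N j
  where
  step : ∀ N → (∀ {M} → M < N → ∀ j → u j M ≡ v j M) → ∀ j → u j N ≡ v j N
  step N ih j = downward (N ∸ j) j (ℕ.m≤n+m∸n N j)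
    where
    solve-for-u : ∀ {x y z} → x +ᶻ y ≡ z → x ≡ z - y
    solve-for-u {x} {y} eq = trans (add-sub x y) (cong (_- y) eq)
      where
      add-sub : ∀ x y → x ≡ x +ᶻ y - y
      add-sub = solve-∀
    downward : ∀ k j → N ≤ j + k → u j N ≡ v j N
    downward zero    j N≤j = trans (van-u j N N≤j′) (sym (van-v j N N≤j′))
      where N≤j′ = subst (N ≤_) (ℕ.+-identityʳ j) N≤j
    downward (suc k) j N≤j+1+k = begin
      u j N                                                         ≡⟨ solve-for-u (fe-u j N) ⟩
      shift (suc j) (λ M → one M +ᶻ u (suc j) M) N - u (suc j) N    ≡⟨ cong₂ _-_ earlier (downward k (suc j) (subst (N ≤_) (ℕ.+-suc j k) N≤j+1+k)) ⟩
      shift (suc j) (λ M → one M +ᶻ v (suc j) M) N - v (suc j) N    ≡⟨ sym (solve-for-u (fe-v j N)) ⟩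
      v j N                                                         ∎
      where
      open ≡-Reasoning
      earlier : shift (suc j) (λ M → one M +ᶻ u (suc j) M) N ≡ shift (suc j) (λ M → one M +ᶻ v (suc j) M) N
      earlier = shift-cong (suc j) (λ M → one M +ᶻ u (suc j) M) (λ M → one M +ᶻ v (suc j) M) N
                   (λ j<N → cong (one (N ∸ suc j) +ᶻ_) (ih (ℕ.∸-monoʳ-< (s≤s z≤n) j<N) (suc j)))

shift-one+Σ< : ∀ j N′ (w : ℕ → PS) (u : PS) → (∀ M → M ≤ N′ ∸ j → Σ< N′ (λ m → w m M) ≡ u M)
  → shift (suc j) one (suc N′) +ᶻ Σ< N′ (λ m → shift (suc j) (w m) (suc N′)) ≡ shift (suc j) (λ M → one M +ᶻ u M) (suc N′)
shift-one+Σ< j N′ w u eq = begin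
  shift (suc j) one (suc N′) +ᶻ Σ< N′ (λ m → shift (suc j) (w m) (suc N′))
      ≡⟨ cong (shift (suc j) one (suc N′) +ᶻ_) (sym (shift-Σ< (suc j) N′ w (suc N′))) ⟩
  shift (suc j) one (suc N′) +ᶻ shift (suc j) (λ M → Σ< N′ (λ m → w m M)) (suc N′)
      ≡⟨ cong (shift (suc j) one (suc N′) +ᶻ_) (shift-cong (suc j) (λ M → Σ< N′ (λ m → w m M)) u (suc N′) (λ _ → eq (N′ ∸ j) ℕ.≤-refl)) ⟩
  shift (suc j) one (suc N′) +ᶻ shift (suc j) u (suc N′)
      ≡⟨ sym (shift-+ᶻ (suc j) one u (suc N′)) ⟩
  shift (suc j) (λ M → one M +ᶻ u M) (suc N′) ∎
  where open ≡-Reasoning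

-- The left side, split along the expansion of 1/(1 - q^n)

invNegQPoch-recurrence : ∀ n → Recurrence (invNegQPoch n) -1ℤ (suc n) (invNegQPoch (suc n))
invNegQPoch-recurrence n = recurrence-⊛ʳ { -1ℤ} {n} {geom -1ℤ (suc n)} (invNegQPoch n) (geom-recurrence -1ℤ n)

invNegQPoch-step : ∀ n M → invNegQPoch n M ≡ invNegQPoch (suc n) M +ᶻ shift (suc n) (invNegQPoch (suc n)) M
invNegQPoch-step n M = begin
  invNegQPoch n M                   ≡⟨ rearrange (invNegQPoch n M) s ⟩
  invNegQPoch n M +ᶻ -1ℤ *ᶻ s +ᶻ s   ≡⟨ cong (λ x → invNegQPoch n M +ᶻ x +ᶻ s) (sym (shift-*ˡ (suc n) -1ℤ (invNegQPoch (suc n)) M)) ⟩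
  invNegQPoch n M +ᶻ shift (suc n) (λ K → -1ℤ *ᶻ invNegQPoch (suc n) K) M +ᶻ s
                                    ≡⟨ cong (_+ᶻ s) (sym (invNegQPoch-recurrence n M)) ⟩
  invNegQPoch (suc n) M +ᶻ s         ∎
  where
  open ≡-Reasoning
  s = shift (suc n) (invNegQPoch (suc n)) M
  rearrange : ∀ x y → x ≡ x +ᶻ -1ℤ *ᶻ y +ᶻ y
  rearrange = solve-∀

triangle : ℕ → ℕ
triangle n = (n * suc n) ℕ./ 2

triangle-suc : ∀ n → triangle (suc n) ≡ triangle n + suc n
triangle-suc n = begin
  (suc n * suc (suc n)) ℕ./ 2           ≡⟨ cong (ℕ._/ 2) (expand n) ⟩
  (n * suc n + suc n * 2) ℕ./ 2         ≡⟨ DivMod.+-distrib-/-∣ʳ (n * suc n) (Div.n∣m*n (suc n)) ⟩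
  triangle n + (suc n * 2) ℕ./ 2        ≡⟨ cong (λ x → triangle n + x) (DivMod.m*n/n≡m (suc n) 2) ⟩
  triangle n + suc n                    ∎
  where
  open ≡-Reasoning
  expand : ∀ n → suc n * suc (suc n) ≡ n * suc n + suc n * 2
  expand = ℕ-solve-∀

n≤triangle : ∀ n → n ≤ triangle n
n≤triangle zero    = z≤n
n≤triangle (suc n) = subst (suc n ≤_) (sym (triangle-suc n)) (ℕ.m≤n+m (suc n) (triangle n))

lhsExp : ℕ → ℕ → ℕ
lhsExp j n = triangle (suc n) + suc n * j

lhsExp-sucˡ : ∀ j n → lhsExp (suc j) n ≡ lhsExp j n + suc n
lhsExp-sucˡ j n = arrange (triangle (suc n)) n j
  where
  arrange : ∀ t n j → t + suc n * suc j ≡ t + suc n * j + suc n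
  arrange = ℕ-solve-∀

lhsExp-zeroʳ : ∀ j → lhsExp j 0 ≡ suc j
lhsExp-zeroʳ j = cong suc (ℕ.+-identityʳ j)

lhsExp-sucʳ : ∀ j m → lhsExp j (suc m) ≡ suc j + lhsExp (suc j) m
lhsExp-sucʳ j m = trans (cong (_+ suc (suc m) * j) (triangle-suc (suc m))) (arrange (triangle (suc m)) m j)
  where
  arrange : ∀ t m j → t + suc (suc m) + suc (suc m) * j ≡ suc j + (t + suc m * suc j)
  arrange = ℕ-solve-∀

lhsExp-≥ : ∀ j n → suc j + n ≤ lhsExp j n
lhsExp-≥ j n = subst (_≤ lhsExp j n) (cong suc (ℕ.+-comm n j))
                     (ℕ.+-mono-≤ (n≤triangle (suc n)) (ℕ.m≤n*m j (suc n)))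

-- lhsPiece j n = q^(T (n+1) + (n+1) j) / (-q;q)_(n+1); the sum over j is lhsTerm (n+1).
lhsPiece : ℕ → ℕ → PS
lhsPiece j n = shift (lhsExp j n) (invNegQPoch (suc n))

lhsPiece-vanishing : ∀ j n {N} → N < suc j + n → lhsPiece j n N ≡ 0ℤ
lhsPiece-vanishing j n N<j+n = shift-< (lhsExp j n) (invNegQPoch (suc n)) (ℕ.<-≤-trans N<j+n (lhsExp-≥ j n))

lhsSlice : ℕ → PS
lhsSlice j N = Σ< N (λ n → lhsPiece j n N)

lhsSlice-range : ∀ j {N R} → N ≤ R → Σ< R (λ n → lhsPiece j n N) ≡ lhsSlice j N
lhsSlice-range j {N} {R} = Σ<-truncate N R (λ n N≤n → lhsPiece-vanishing j n (s≤s (ℕ.≤-trans N≤n (ℕ.m≤n+m n j))))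

lhsSlice-vanishing : Vanishing lhsSlice
lhsSlice-vanishing j N N≤j = Σ<-zero N (λ n _ → lhsPiece-vanishing j n (s≤s (ℕ.≤-trans N≤j (ℕ.m≤m+n j n))))

lhsTerm-expand : ∀ n N → lhsTerm (suc n) N ≡ Σ< (suc N) (λ j → lhsPiece j n N)
lhsTerm-expand n N with triangle (suc n) ≤? N
... | no T≰N = trans (shift-< (triangle (suc n)) (geom 1ℤ (suc n) ⊛ invNegQPoch (suc n)) (ℕ.≰⇒> T≰N))
                     (sym (Σ<-zero (suc N) (λ j _ → shift-< (lhsExp j n) (invNegQPoch (suc n))
                                                        (ℕ.<-≤-trans (ℕ.≰⇒> T≰N) (ℕ.m≤m+n _ (suc n * j))))))
... | yes T≤N = begin
  shift T (geom 1ℤ (suc n) ⊛ invNegQPoch (suc n)) N                   ≡⟨ shift-≥ T (geom 1ℤ (suc n) ⊛ invNegQPoch (suc n)) T≤N ⟩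
  (geom 1ℤ (suc n) ⊛ invNegQPoch (suc n)) (N ∸ T)                     ≡⟨ recurrence-expand {invNegQPoch (suc n)} rec (suc N) (N ∸ T) (s≤s (ℕ.m∸n≤m N T)) ⟩
  Σ< (suc N) (λ j → shift (suc n * j) (invNegQPoch (suc n)) (N ∸ T))  ≡⟨ Σ<-ext (suc N) (λ j → shift-∸ T (suc n * j) (invNegQPoch (suc n)) T≤N) ⟩
  Σ< (suc N) (λ j → lhsPiece j n N)                                   ∎
  where
  open ≡-Reasoning
  T = triangle (suc n)
  rec : Recurrence (invNegQPoch (suc n)) 1ℤ (suc n) (geom 1ℤ (suc n) ⊛ invNegQPoch (suc n))
  rec = recurrence-⊛ˡ {1ℤ} {n} {geom 1ℤ (suc n)} (invNegQPoch (suc n)) (geom-recurrence 1ℤ n)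

seriesCoeff-Σ< : ∀ (t : ℕ → PS) N → seriesCoeff t N ≡ Σ< N (λ n → t (suc n) N)
seriesCoeff-Σ< t N = sumℤ-map-applyUpTo N (λ n → t (suc n) N) (λ i → i)

lhs-slices : ∀ N → seriesCoeff lhsTerm N ≡ Σ< (suc N) (λ j → lhsSlice j N)
lhs-slices N = begin
  seriesCoeff lhsTerm N                                 ≡⟨ seriesCoeff-Σ< lhsTerm N ⟩
  Σ< N (λ n → lhsTerm (suc n) N)                        ≡⟨ Σ<-ext N (λ n → lhsTerm-expand n N) ⟩
  Σ< N (λ n → Σ< (suc N) (λ j → lhsPiece j n N))        ≡⟨ Σ<-swap N (suc N) (λ n j → lhsPiece j n N) ⟩
  Σ< (suc N) (λ j → lhsSlice j N)                       ∎
  where open ≡-Reasoning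

lhsSlice-functionalEquation : FunctionalEquation lhsSlice
lhsSlice-functionalEquation j N = begin
  lhsSlice j N +ᶻ lhsSlice (suc j) N                               ≡⟨ sym (Σ<-+ N (λ n → lhsPiece j n N) (λ n → lhsPiece (suc j) n N)) ⟩
  Σ< N (λ n → lhsPiece j n N +ᶻ lhsPiece (suc j) n N)              ≡⟨ Σ<-ext N merge ⟩
  Σ< N (λ n → shift (lhsExp j n) (invNegQPoch n) N)                ≡⟨ peel N ⟩
  shift (suc j) (λ M → one M +ᶻ lhsSlice (suc j) M) N              ∎
  where
  open ≡-Reasoning
  merge : ∀ n → lhsPiece j n N +ᶻ lhsPiece (suc j) n N ≡ shift (lhsExp j n) (invNegQPoch n) N
  merge n = begin
    shift e α′ N +ᶻ shift (lhsExp (suc j) n) α′ N              ≡⟨ cong (λ i → shift e α′ N +ᶻ shift i α′ N) (lhsExp-sucˡ j n) ⟩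
    shift e α′ N +ᶻ shift (e + suc n) α′ N                     ≡⟨ cong (shift e α′ N +ᶻ_) (sym (shift-shift e (suc n) α′ N)) ⟩
    shift e α′ N +ᶻ shift e (shift (suc n) α′) N               ≡⟨ sym (shift-+ᶻ e α′ (shift (suc n) α′) N) ⟩
    shift e (λ M → α′ M +ᶻ shift (suc n) α′ M) N               ≡⟨ shift-cong e (λ M → α′ M +ᶻ shift (suc n) α′ M) (invNegQPoch n) N (λ _ → sym (invNegQPoch-step n (N ∸ e))) ⟩
    shift e (invNegQPoch n) N                                  ∎
    where
    e = lhsExp j n
    α′ = invNegQPoch (suc n)
  later : ∀ N′ m → shift (lhsExp j (suc m)) (invNegQPoch (suc m)) N′ ≡ shift (suc j) (lhsPiece (suc j) m) N′
  later N′ m = trans (cong (λ i → shift i (invNegQPoch (suc m)) N′) (lhsExp-sucʳ j m))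
                     (sym (shift-shift (suc j) (lhsExp (suc j) m) (invNegQPoch (suc m)) N′))
  peel : ∀ N → Σ< N (λ n → shift (lhsExp j n) (invNegQPoch n) N) ≡ shift (suc j) (λ M → one M +ᶻ lhsSlice (suc j) M) N
  peel zero     = sym (shift-< (suc j) (λ M → one M +ᶻ lhsSlice (suc j) M) (s≤s z≤n))
  peel (suc N′) = begin
    shift (lhsExp j 0) one (suc N′) +ᶻ Σ< N′ (λ m → shift (lhsExp j (suc m)) (invNegQPoch (suc m)) (suc N′))
        ≡⟨ cong₂ _+ᶻ_ (cong (λ i → shift i one (suc N′)) (lhsExp-zeroʳ j)) (Σ<-ext N′ (later (suc N′))) ⟩
    shift (suc j) one (suc N′) +ᶻ Σ< N′ (λ m → shift (suc j) (lhsPiece (suc j) m) (suc N′))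
        ≡⟨ shift-one+Σ< j N′ (lhsPiece (suc j)) (lhsSlice (suc j)) (λ M M≤N′∸j → lhsSlice-range (suc j) (ℕ.≤-trans M≤N′∸j (ℕ.m∸n≤m N′ j))) ⟩
    shift (suc j) (λ M → one M +ᶻ lhsSlice (suc j) M) (suc N′) ∎

-1^ : ℕ → ℤ
-1^ zero    = 1ℤ
-1^ (suc n) = -ᶻ -1^ n

-1^-parity : ∀ n → (-1^ n ≡ 1ℤ × 2 ∣ n) ⊎ (-1^ n ≡ -1ℤ × 2 ∣ suc n)
-1^-parity zero = inj₁ (refl , 2 Div.∣0)
-1^-parity (suc n) with -1^-parity n
... | inj₁ (s , 2∣n)   = inj₂ (cong -ᶻ_ s , Div.∣m∣n⇒∣m+n (Div.∣-refl {2}) 2∣n)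
... | inj₂ (s , 2∣1+n) = inj₁ (cong -ᶻ_ s , 2∣1+n)

2∣n⇒2∤1+n : ∀ {n} → 2 ∣ n → ¬ 2 ∣ suc n
2∣n⇒2∤1+n {n} 2∣n 2∣1+n with Div.∣1⇒≡1 (Div.∣m+n∣m⇒∣n (subst (2 ∣_) (ℕ.+-comm 1 n) 2∣1+n) 2∣n)
... | ()

-1^-odd : ∀ {n} → ¬ 2 ∣ n → -1^ n ≡ -1ℤ
-1^-odd {n} 2∤n with -1^-parity n
... | inj₁ (_ , 2∣n) = ⊥-elim (2∤n 2∣n)
... | inj₂ (s , _)   = s

-1^-even : ∀ {n} → 2 ∣ n → -1^ n ≡ 1ℤ
-1^-even {n} 2∣n with -1^-parity n
... | inj₁ (s , _)     = s
... | inj₂ (_ , 2∣1+n) = ⊥-elim (2∣n⇒2∤1+n 2∣n 2∣1+n)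

if-2∣ : ∀ n → (if does (2 ∣? n) then 1ℤ else -1ℤ) ≡ -1^ n
if-2∣ n with -1^-parity n
... | inj₁ (s , 2∣n)   = trans (if-yes (2 ∣? n) 2∣n) (sym s)
... | inj₂ (s , 2∣1+n) = trans (if-no (2 ∣? n) (λ 2∣n → 2∣n⇒2∤1+n 2∣n 2∣1+n)) (sym s)

-1^-square : ∀ n → -1^ n *ᶻ -1^ n ≡ 1ℤ
-1^-square zero    = refl
-1^-square (suc n) = trans (neg*neg (-1^ n)) (-1^-square n)
  where
  neg*neg : ∀ x → -ᶻ x *ᶻ -ᶻ x ≡ x *ᶻ x
  neg*neg = solve-∀

-- The explicit solution Σ_n (-1)^n q^(j+1+n) (q^(j+1);q)_n of the functional equation

-- poch j n = (q^(j+1);q)_n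
poch : ℕ → ℕ → PS
poch j zero        = one
poch j (suc n) M   = poch j n M - shift (suc j + n) (poch j n) M

poch-low : ∀ j n {M} → M ≤ j → poch j n M ≡ one M
poch-low j zero    M≤j = refl
poch-low j (suc n) {M} M≤j = begin
  poch j n M - shift (suc j + n) (poch j n) M   ≡⟨ cong₂ _-_ (poch-low j n M≤j) (shift-< (suc j + n) (poch j n) (s≤s (ℕ.≤-trans M≤j (ℕ.m≤m+n j n)))) ⟩
  one M - 0ℤ                                   ≡⟨ ℤ.+-identityʳ (one M) ⟩
  one M                                        ∎
  where open ≡-Reasoning

poch-suc : ∀ j n M → poch j (suc n) M ≡ poch (suc j) n M - shift (suc j) (poch (suc j) n) M
poch-suc j zero M = cong (λ i → one M - shift i one M) (ℕ.+-identityʳ (suc j))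
poch-suc j (suc n) M = begin
  poch j (suc n) M - shift (suc j + suc n) (poch j (suc n)) M
      ≡⟨ cong₂ _-_ (poch-suc j n M) (shift-cong (suc j + suc n) (poch j (suc n)) (λ K → X K - shift (suc j) X K) M (λ _ → poch-suc j n _)) ⟩
  X M - shift (suc j) X M - shift (suc j + suc n) (λ K → X K - shift (suc j) X K) M
      ≡⟨ cong (X M - shift (suc j) X M -_) (shift-- (suc j + suc n) X (shift (suc j) X) M) ⟩
  X M - shift (suc j) X M - (shift (suc j + suc n) X M - shift (suc j + suc n) (shift (suc j) X) M)
      ≡⟨ cong₂ (λ a b → X M - shift (suc j) X M - (shift a X M - b)) (ℕ.+-suc (suc j) n) (shift-shift (suc j + suc n) (suc j) X M) ⟩
  X M - shift (suc j) X M - (shift (suc (suc j) + n) X M - shift (suc j + suc n + suc j) X M)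
      ≡⟨ cong (λ i → X M - shift (suc j) X M - (shift (suc (suc j) + n) X M - shift i X M)) (reindex j n) ⟩
  X M - shift (suc j) X M - (shift (suc (suc j) + n) X M - shift (suc j + (suc (suc j) + n)) X M)
      ≡⟨ exchange (X M) (shift (suc j) X M) (shift (suc (suc j) + n) X M) (shift (suc j + (suc (suc j) + n)) X M) ⟩
  X M - shift (suc (suc j) + n) X M - (shift (suc j) X M - shift (suc j + (suc (suc j) + n)) X M)
      ≡⟨ cong (X M - shift (suc (suc j) + n) X M -_) (sym (trans (shift-- (suc j) X (shift (suc (suc j) + n) X) M)
                                                               (cong (shift (suc j) X M -_) (shift-shift (suc j) (suc (suc j) + n) X M)))) ⟩
  poch (suc j) (suc n) M - shift (suc j) (poch (suc j) (suc n)) M ∎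
  where
  open ≡-Reasoning
  X = poch (suc j) n
  reindex : ∀ j n → suc j + suc n + suc j ≡ suc j + (suc (suc j) + n)
  reindex = ℕ-solve-∀
  exchange : ∀ x a c d → x - a - (c - d) ≡ x - c - (a - d)
  exchange = solve-∀

pochPiece : ℕ → ℕ → PS
pochPiece j n N = -1^ n *ᶻ shift (suc j + n) (poch j n) N

pochPiece-vanishing : ∀ j n {N} → N ≤ j + n → pochPiece j n N ≡ 0ℤ
pochPiece-vanishing j n N≤j+n = trans (cong (-1^ n *ᶻ_) (shift-< (suc j + n) (poch j n) (s≤s N≤j+n))) (ℤ.*-zeroʳ (-1^ n))

pochSlice : ℕ → PS
pochSlice j N = Σ< N (λ n → pochPiece j n N)

pochSlice-range : ∀ j {N R} → N ≤ R → Σ< R (λ n → pochPiece j n N) ≡ pochSlice j N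
pochSlice-range j {N} {R} = Σ<-truncate N R (λ n N≤n → pochPiece-vanishing j n (ℕ.≤-trans N≤n (ℕ.m≤n+m n j)))

pochSlice-vanishing : Vanishing pochSlice
pochSlice-vanishing j N N≤j = Σ<-zero N (λ n _ → pochPiece-vanishing j n (ℕ.≤-trans N≤j (ℕ.m≤m+n j n)))

pochPiece-merge : ∀ j m N → pochPiece j (suc m) N +ᶻ pochPiece (suc j) m N ≡ shift (suc j) (pochPiece (suc j) m) N
pochPiece-merge j m N = begin
  -ᶻ s *ᶻ shift (suc j + suc m) (poch j (suc m)) N +ᶻ s *ᶻ Y
      ≡⟨ cong (λ t → -ᶻ s *ᶻ t +ᶻ s *ᶻ Y) lower ⟩
  -ᶻ s *ᶻ (Y - Z) +ᶻ s *ᶻ Y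
      ≡⟨ cancel s Y Z ⟩
  s *ᶻ Z
      ≡⟨ cong (s *ᶻ_) (sym (shift-shift (suc j) (suc (suc j) + m) X N)) ⟩
  s *ᶻ shift (suc j) (shift (suc (suc j) + m) X) N
      ≡⟨ sym (shift-*ˡ (suc j) s (shift (suc (suc j) + m) X) N) ⟩
  shift (suc j) (pochPiece (suc j) m) N ∎
  where
  open ≡-Reasoning
  s = -1^ m
  X = poch (suc j) m
  Y = shift (suc (suc j) + m) X N
  Z = shift (suc j + (suc (suc j) + m)) X N
  lower : shift (suc j + suc m) (poch j (suc m)) N ≡ Y - Z
  lower = begin
    shift (suc j + suc m) (poch j (suc m)) N
        ≡⟨ shift-cong (suc j + suc m) (poch j (suc m)) (λ K → X K - shift (suc j) X K) N (λ _ → poch-suc j m _) ⟩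
    shift (suc j + suc m) (λ K → X K - shift (suc j) X K) N
        ≡⟨ shift-- (suc j + suc m) X (shift (suc j) X) N ⟩
    shift (suc j + suc m) X N - shift (suc j + suc m) (shift (suc j) X) N
        ≡⟨ cong₂ (λ a b → shift a X N - b) (ℕ.+-suc (suc j) m) (shift-shift (suc j + suc m) (suc j) X N) ⟩
    Y - shift (suc j + suc m + suc j) X N
        ≡⟨ cong (λ i → Y - shift i X N) (reindex j m) ⟩
    Y - Z ∎
    where
    reindex : ∀ j m → suc j + suc m + suc j ≡ suc j + (suc (suc j) + m)
    reindex = ℕ-solve-∀
  cancel : ∀ s y z → -ᶻ s *ᶻ (y - z) +ᶻ s *ᶻ y ≡ s *ᶻ z
  cancel = solve-∀

pochSlice-functionalEquation : FunctionalEquation pochSlice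
pochSlice-functionalEquation j zero     = sym (shift-< (suc j) (λ M → one M +ᶻ pochSlice (suc j) M) (s≤s z≤n))
pochSlice-functionalEquation j (suc N′) = begin
  (pochPiece j 0 N +ᶻ Σ< N′ (λ m → pochPiece j (suc m) N)) +ᶻ pochSlice (suc j) N
      ≡⟨ cong (pochPiece j 0 N +ᶻ Σ< N′ (λ m → pochPiece j (suc m) N) +ᶻ_) (sym upper) ⟩
  (pochPiece j 0 N +ᶻ Σ< N′ (λ m → pochPiece j (suc m) N)) +ᶻ Σ< N′ (λ m → pochPiece (suc j) m N)
      ≡⟨ ℤ.+-assoc (pochPiece j 0 N) _ _ ⟩
  pochPiece j 0 N +ᶻ (Σ< N′ (λ m → pochPiece j (suc m) N) +ᶻ Σ< N′ (λ m → pochPiece (suc j) m N))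
      ≡⟨ cong₂ _+ᶻ_ first (sym (Σ<-+ N′ (λ m → pochPiece j (suc m) N) (λ m → pochPiece (suc j) m N))) ⟩
  shift (suc j) one N +ᶻ Σ< N′ (λ m → pochPiece j (suc m) N +ᶻ pochPiece (suc j) m N)
      ≡⟨ cong (shift (suc j) one N +ᶻ_) (Σ<-ext N′ (λ m → pochPiece-merge j m N)) ⟩
  shift (suc j) one N +ᶻ Σ< N′ (λ m → shift (suc j) (pochPiece (suc j) m) N)
      ≡⟨ shift-one+Σ< j N′ (pochPiece (suc j)) (pochSlice (suc j)) (λ M M≤N′∸j → pochSlice-range (suc j) (ℕ.≤-trans M≤N′∸j (ℕ.m∸n≤m N′ j))) ⟩
  shift (suc j) (λ M → one M +ᶻ pochSlice (suc j) M) N ∎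
  where
  open ≡-Reasoning
  N = suc N′
  upper : Σ< N′ (λ m → pochPiece (suc j) m N) ≡ pochSlice (suc j) N
  upper = sym (Σ<-truncate N′ N (λ m N′≤m → pochPiece-vanishing (suc j) m (s≤s (ℕ.≤-trans N′≤m (ℕ.m≤n+m m j)))) (ℕ.n≤1+n N′))
  first : pochPiece j 0 N ≡ shift (suc j) one N
  first = trans (ℤ.*-identityˡ _) (cong (λ i → shift i one N) (ℕ.+-identityʳ (suc j)))

pochSum : ℕ → PS
pochSum n N = Σ< (suc N) (λ j → shift j (poch j n) N)

pochSum-range : ∀ n {N R} → N < R → Σ< R (λ j → shift j (poch j n) N) ≡ pochSum n N
pochSum-range n {N} {R} = Σ<-truncate (suc N) R (λ j N<j → shift-< j (poch j n) N<j)

shift-pochSum : ∀ n N → shift (suc n) (pochSum n) N ≡ Σ< (suc N) (λ j → shift (suc n + j) (poch j n) N)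
shift-pochSum n N = begin
  shift (suc n) (pochSum n) N
      ≡⟨ shift-cong (suc n) (pochSum n) (λ M → Σ< (suc N) (λ j → shift j (poch j n) M)) N
                    (λ _ → sym (pochSum-range n (s≤s (ℕ.m∸n≤m N (suc n))))) ⟩
  shift (suc n) (λ M → Σ< (suc N) (λ j → shift j (poch j n) M)) N
      ≡⟨ shift-Σ< (suc n) (suc N) (λ j → shift j (poch j n)) N ⟩
  Σ< (suc N) (λ j → shift (suc n) (shift j (poch j n)) N)
      ≡⟨ Σ<-ext (suc N) (λ j → shift-shift (suc n) j (poch j n) N) ⟩
  Σ< (suc N) (λ j → shift (suc n + j) (poch j n) N) ∎
  where open ≡-Reasoning

-- pochDiff n j = (1 - q^j) (q^(j+1);q)_n = (q^j;q)_(n+1)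
pochDiff : ℕ → ℕ → PS
pochDiff n j N = poch j n N - shift j (poch j n) N

pochDiff-suc : ∀ n j N → pochDiff n (suc j) N - pochDiff n j N ≡ shift j (poch j n) N - shift (suc n + j) (poch j n) N
pochDiff-suc n j N = begin
  pochDiff n (suc j) N - pochDiff n j N                                 ≡⟨ cong (_- pochDiff n j N) (sym (poch-suc j n N)) ⟩
  poch j n N - shift (suc j + n) (poch j n) N - pochDiff n j N         ≡⟨ cong (λ i → poch j n N - shift i (poch j n) N - pochDiff n j N) (cong suc (ℕ.+-comm j n)) ⟩
  poch j n N - shift (suc n + j) (poch j n) N - pochDiff n j N         ≡⟨ cancel (poch j n N) _ _ ⟩
  shift j (poch j n) N - shift (suc n + j) (poch j n) N                ∎
  where
  open ≡-Reasoning
  cancel : ∀ p a c → p - a - (p - c) ≡ c - a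
  cancel = solve-∀

pochSum-recurrence : ∀ n → Recurrence one 1ℤ (suc n) (pochSum n)
pochSum-recurrence n N = begin
  pochSum n N                                           ≡⟨ rearrange (pochSum n N) (shift (suc n) (pochSum n) N) ⟩
  (pochSum n N - shift (suc n) (pochSum n) N) +ᶻ shift (suc n) (pochSum n) N
                                                        ≡⟨ cong₂ _+ᶻ_ difference (shift-cong (suc n) (pochSum n) (λ M → 1ℤ *ᶻ pochSum n M) N (λ _ → sym (ℤ.*-identityˡ _))) ⟩
  one N +ᶻ shift (suc n) (λ M → 1ℤ *ᶻ pochSum n M) N    ∎
  where
  open ≡-Reasoning
  rearrange : ∀ x y → x ≡ (x - y) +ᶻ y
  rearrange = solve-∀
  difference : pochSum n N - shift (suc n) (pochSum n) N ≡ one N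
  difference = begin
    pochSum n N - shift (suc n) (pochSum n) N
        ≡⟨ cong (pochSum n N -_) (shift-pochSum n N) ⟩
    Σ< (suc N) (λ j → shift j (poch j n) N) - Σ< (suc N) (λ j → shift (suc n + j) (poch j n) N)
        ≡⟨ sym (Σ<-- (suc N) (λ j → shift j (poch j n) N) (λ j → shift (suc n + j) (poch j n) N)) ⟩
    Σ< (suc N) (λ j → shift j (poch j n) N - shift (suc n + j) (poch j n) N)
        ≡⟨ sym (Σ<-ext (suc N) (λ j → pochDiff-suc n j N)) ⟩
    Σ< (suc N) (λ j → pochDiff n (suc j) N - pochDiff n j N)
        ≡⟨ telescope (suc N) (λ j → pochDiff n j N) ⟩
    pochDiff n (suc N) N - pochDiff n 0 N
        ≡⟨ cong₂ _-_ top (ℤ.+-inverseʳ (poch 0 n N)) ⟩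
    one N - 0ℤ
        ≡⟨ ℤ.+-identityʳ (one N) ⟩
    one N ∎
    where
    top : pochDiff n (suc N) N ≡ one N
    top = trans (cong₂ _-_ (poch-low (suc N) n (ℕ.n≤1+n N)) (shift-< (suc N) (poch (suc N) n) ℕ.≤-refl)) (ℤ.+-identityʳ (one N))

-- Lambert series as sums over factorisations N = (n+1)(k+1)

shift-geom : ∀ a m N → shift (suc m) (geom a (suc m)) N ≡ Σ< N (λ k → when (suc m * suc k ≟ N) (a ℤ.^ k))
shift-geom a m N with suc m ≤? N
... | no m≰N = trans (shift-< (suc m) (geom a (suc m)) (ℕ.≰⇒> m≰N))
                     (sym (Σ<-zero N (λ k _ → if-no (suc m * suc k ≟ N) (λ e → m≰N (subst (suc m ≤_) e (ℕ.m≤m*n (suc m) (suc k)))))))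
... | yes m≤N with ℕ.m≤n⇒∃[o]m+o≡n m≤N
...   | N′ , refl = begin
  shift (suc m) (geom a (suc m)) (suc m + N′)                             ≡⟨ shift-+ (suc m) (geom a (suc m)) N′ ⟩
  geom a (suc m) N′                                                       ≡⟨ Σ≤≡Σ< N′ (λ k → when (suc m * k ≟ N′) (a ℤ.^ k)) ⟩
  Σ< (suc N′) (λ k → when (suc m * k ≟ N′) (a ℤ.^ k))                     ≡⟨ Σ<-ext (suc N′) reindex ⟩
  Σ< (suc N′) (λ k → when (suc m * suc k ≟ suc m + N′) (a ℤ.^ k))         ≡⟨ sym (Σ<-truncate (suc N′) (suc m + N′) beyond (s≤s (ℕ.m≤n+m N′ m))) ⟩
  Σ< (suc m + N′) (λ k → when (suc m * suc k ≟ suc m + N′) (a ℤ.^ k))     ∎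
  where
  open ≡-Reasoning
  reindex : ∀ k → when (suc m * k ≟ N′) (a ℤ.^ k) ≡ when (suc m * suc k ≟ suc m + N′) (a ℤ.^ k)
  reindex k = when-cong (suc m * k ≟ N′) (suc m * suc k ≟ suc m + N′)
                (λ e → trans (ℕ.*-suc (suc m) k) (cong (λ i → suc m + i) e))
                (λ e → ℕ.+-cancelˡ-≡ (suc m) _ _ (trans (sym (ℕ.*-suc (suc m) k)) e))
                (λ _ → refl)
  beyond : ∀ k → suc N′ ≤ k → when (suc m * suc k ≟ suc m + N′) (a ℤ.^ k) ≡ 0ℤ
  beyond k N′<k = if-no (suc m * suc k ≟ suc m + N′) (λ e → ℕ.<-irrefl (sym e) (too-big k N′<k))
    where
    too-big : ∀ k → suc N′ ≤ k → suc m + N′ < suc m * suc k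
    too-big k N′<k = subst (suc m + N′ <_) (sym (ℕ.*-suc (suc m) k))
                           (ℕ.+-monoʳ-< (suc m) (ℕ.<-≤-trans N′<k (ℕ.m≤n*m k (suc m))))

-1ℤ^≡-1^ : ∀ k → -1ℤ ℤ.^ k ≡ -1^ k
-1ℤ^≡-1^ zero    = refl
-1ℤ^≡-1^ (suc k) = trans (ℤ.-1*i≡-i (-1ℤ ℤ.^ k)) (cong -ᶻ_ (-1ℤ^≡-1^ k))

factorSum : (ℕ → ℕ → ℤ) → ℕ → ℤ
factorSum c N = Σ< N (λ n → Σ< N (λ k → when (suc n * suc k ≟ N) (c n k)))

factorSum-transpose : ∀ c N → factorSum c N ≡ factorSum (λ n k → c k n) N
factorSum-transpose c N = trans (Σ<-swap N N (λ n k → when (suc n * suc k ≟ N) (c n k)))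
  (Σ<-ext N (λ k → Σ<-ext N (λ n → when-cong (suc n * suc k ≟ N) (suc k * suc n ≟ N)
                                      (trans (ℕ.*-comm (suc k) (suc n))) (trans (ℕ.*-comm (suc n) (suc k))) (λ _ → refl))))

rhs-factorSum : ∀ N → seriesCoeff rhsTerm N ≡ factorSum (λ i k → -1^ k) N
rhs-factorSum N = trans (seriesCoeff-Σ< rhsTerm N)
  (Σ<-ext N (λ n → trans (shift-geom -1ℤ n N) (Σ<-ext N (λ k → cong (when (suc n * suc k ≟ N)) (-1ℤ^≡-1^ k)))))

pochSlices-factorSum : ∀ N → Σ< (suc N) (λ j → pochSlice j N) ≡ factorSum (λ i k → -1^ i) N
pochSlices-factorSum N = begin
  Σ< (suc N) (λ j → Σ< N (λ n → pochPiece j n N))                           ≡⟨ Σ<-swap (suc N) N (λ j n → pochPiece j n N) ⟩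
  Σ< N (λ n → Σ< (suc N) (λ j → -1^ n *ᶻ shift (suc j + n) (poch j n) N))   ≡⟨ Σ<-ext N (λ n → Σ<-*ˡ (suc N) (-1^ n) (λ j → shift (suc j + n) (poch j n) N)) ⟩
  Σ< N (λ n → -1^ n *ᶻ Σ< (suc N) (λ j → shift (suc j + n) (poch j n) N))   ≡⟨ Σ<-ext N (λ n → cong (-1^ n *ᶻ_) (column n)) ⟩
  Σ< N (λ n → -1^ n *ᶻ Σ< N (λ k → when (suc n * suc k ≟ N) 1ℤ))            ≡⟨ Σ<-ext N (λ n → sym (Σ<-*ˡ N (-1^ n) (λ k → when (suc n * suc k ≟ N) 1ℤ))) ⟩
  Σ< N (λ n → Σ< N (λ k → -1^ n *ᶻ when (suc n * suc k ≟ N) 1ℤ))            ≡⟨ Σ<-ext N (λ n → Σ<-ext N (λ k → scale (suc n * suc k ≟ N) (-1^ n))) ⟩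
  factorSum (λ i k → -1^ i) N                                               ∎
  where
  open ≡-Reasoning
  column : ∀ n → Σ< (suc N) (λ j → shift (suc j + n) (poch j n) N) ≡ Σ< N (λ k → when (suc n * suc k ≟ N) 1ℤ)
  column n = begin
    Σ< (suc N) (λ j → shift (suc j + n) (poch j n) N)   ≡⟨ Σ<-ext (suc N) (λ j → cong (λ i → shift i (poch j n) N) (cong suc (ℕ.+-comm j n))) ⟩
    Σ< (suc N) (λ j → shift (suc n + j) (poch j n) N)   ≡⟨ sym (shift-pochSum n N) ⟩
    shift (suc n) (pochSum n) N                         ≡⟨ shift-cong (suc n) (pochSum n) (geom 1ℤ (suc n)) N (λ _ → pochSum≡geom _) ⟩
    shift (suc n) (geom 1ℤ (suc n)) N                   ≡⟨ shift-geom 1ℤ n N ⟩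
    Σ< N (λ k → when (suc n * suc k ≟ N) (1ℤ ℤ.^ k))    ≡⟨ Σ<-ext N (λ k → cong (when (suc n * suc k ≟ N)) (ℤ.^-zeroˡ k)) ⟩
    Σ< N (λ k → when (suc n * suc k ≟ N) 1ℤ)            ∎
    where
    pochSum≡geom : ∀ M → pochSum n M ≡ geom 1ℤ (suc n) M
    pochSum≡geom = recurrence-unique {one} {1ℤ} {n} (pochSum-recurrence n) (geom-recurrence 1ℤ n)
  scale : ∀ {P : Set} (d : Dec P) s → s *ᶻ when d 1ℤ ≡ when d s
  scale (yes _) s = ℤ.*-identityʳ s
  scale (no _)  s = ℤ.*-zeroʳ s

module _ {A : Set} where

  sumℤ-map-++ : ∀ (f : A → ℤ) xs ys → sumℤ (map f (xs ++ ys)) ≡ sumℤ (map f xs) +ᶻ sumℤ (map f ys)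
  sumℤ-map-++ f []       ys = sym (ℤ.+-identityˡ _)
  sumℤ-map-++ f (x ∷ xs) ys = trans (cong (f x +ᶻ_) (sumℤ-map-++ f xs ys)) (sym (ℤ.+-assoc (f x) _ _))

  sumℤ-map-cong : ∀ {f g : A → ℤ} xs → (∀ x → f x ≡ g x) → sumℤ (map f xs) ≡ sumℤ (map g xs)
  sumℤ-map-cong xs eq = cong sumℤ (ListP.map-cong eq xs)

  sumℤ-map-+ : ∀ (f g : A → ℤ) xs → sumℤ (map (λ x → f x +ᶻ g x) xs) ≡ sumℤ (map f xs) +ᶻ sumℤ (map g xs)
  sumℤ-map-+ f g []       = refl
  sumℤ-map-+ f g (x ∷ xs) = trans (cong (f x +ᶻ g x +ᶻ_) (sumℤ-map-+ f g xs)) (interchange (f x) (g x) _ _)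
    where
    interchange : ∀ a b c d → a +ᶻ b +ᶻ (c +ᶻ d) ≡ a +ᶻ c +ᶻ (b +ᶻ d)
    interchange = solve-∀

  sumℤ-map-*ˡ : ∀ c (f : A → ℤ) xs → sumℤ (map (λ x → c *ᶻ f x) xs) ≡ c *ᶻ sumℤ (map f xs)
  sumℤ-map-*ˡ c f []       = sym (ℤ.*-zeroʳ c)
  sumℤ-map-*ˡ c f (x ∷ xs) = trans (cong (c *ᶻ f x +ᶻ_) (sumℤ-map-*ˡ c f xs)) (sym (ℤ.*-distribˡ-+ c (f x) _))

  sumℤ-map-linear : ∀ (f g : A → ℤ) a b xs
    → sumℤ (map (λ x → a *ᶻ f x +ᶻ b *ᶻ g x) xs) ≡ a *ᶻ sumℤ (map f xs) +ᶻ b *ᶻ sumℤ (map g xs)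
  sumℤ-map-linear f g a b xs = trans (sumℤ-map-+ (λ x → a *ᶻ f x) (λ x → b *ᶻ g x) xs)
                                     (cong₂ _+ᶻ_ (sumℤ-map-*ˡ a f xs) (sumℤ-map-*ˡ b g xs))

  sumℤ-map-zero : ∀ {f : A → ℤ} xs → (∀ x → f x ≡ 0ℤ) → sumℤ (map f xs) ≡ 0ℤ
  sumℤ-map-zero []       eq = refl
  sumℤ-map-zero (x ∷ xs) eq = cong₂ _+ᶻ_ (eq x) (sumℤ-map-zero xs eq)

sumℤ-map-filter : ∀ {A : Set} {P : A → Set} (P? : ∀ x → Dec (P x)) (f : A → ℤ) xs
  → sumℤ (map f (filter P? xs)) ≡ sumℤ (map (λ x → when (P? x) (f x)) xs)
sumℤ-map-filter P? f []       = refl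
sumℤ-map-filter P? f (x ∷ xs) with P? x
... | yes _ = cong (f x +ᶻ_) (sumℤ-map-filter P? f xs)
... | no  _ = trans (sumℤ-map-filter P? f xs) (sym (ℤ.+-identityˡ _))

length≡sumℤ : ∀ {A : Set} (xs : List A) → + length xs ≡ sumℤ (map (λ _ → 1ℤ) xs)
length≡sumℤ []       = refl
length≡sumℤ (x ∷ xs) = trans (sym (ℤ.pos-+ 1 (length xs))) (cong (1ℤ +ᶻ_) (length≡sumℤ xs))

sumℤ-↭ : {xs ys : List ℤ} → xs ↭ ys → sumℤ xs ≡ sumℤ ys
sumℤ-↭ p = foldr-commMonoid ℤ.+-0-isCommutativeMonoid (↭⇒↭ₛ′ isEquivalence p)

sumℤ-map-sameMembers : ∀ {A : Set} (w : A → ℤ) {xs ys : List A} → Unique xs → Unique ys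
  → (∀ {x} → (x ∈ xs) ⇔ (x ∈ ys)) → sumℤ (map w xs) ≡ sumℤ (map w ys)
sumℤ-map-sameMembers w ux uy same = sumℤ-↭ (map⁺ w (∼bag⇒↭ (unique∧set⇒bag ux uy same)))

-- Enumerating partitions into distinct parts, smallest part last

IsDistinctAbove : ℕ → ℕ → List ℕ → Set
IsDistinctAbove s M π = Linked ℕ._>_ π × All (s <_) π × sum π ≡ M

onlyEmpty : ℕ → List (List ℕ)
onlyEmpty zero    = [] ∷ []
onlyEmpty (suc _) = []

snoc : ℕ → List ℕ → List ℕ
snoc y ρ = ρ ++ y ∷ []

-- enumerate f M s: the partitions of M into distinct parts > s, given fuel f ≥ M ∸ s
enumerate : ℕ → ℕ → ℕ → List (List ℕ)
enumerate zero    M s = onlyEmpty M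
enumerate (suc f) M s =
  if does (M ≤? s) then onlyEmpty M
  else enumerate f M (suc s) ++ map (snoc (suc s)) (enumerate f (M ∸ suc s) (suc s))

fuel-zero : ∀ {M s} → M ∸ s ≤ 0 → M ≤ s
fuel-zero M∸s≤0 = ℕ.m∸n≡0⇒m≤n (ℕ.n≤0⇒n≡0 M∸s≤0)

fuel-larger : ∀ M s {f} → M ∸ s ≤ suc f → M ∸ suc s ≤ f
fuel-larger M s {f} M∸s≤1+f = subst (_≤ f) (ℕ.pred[m∸n]≡m∸[1+n] M s) (ℕ.pred-mono-≤ M∸s≤1+f)

fuel-remainder : ∀ M s {f} → M ∸ s ≤ suc f → M ∸ suc s ∸ suc s ≤ f
fuel-remainder M s M∸s≤1+f = ℕ.≤-trans (ℕ.m∸n≤m (M ∸ suc s) (suc s)) (fuel-larger M s M∸s≤1+f)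

enumerate-small : ∀ f {M s} → M ≤ s → enumerate f M s ≡ onlyEmpty M
enumerate-small zero    M≤s = refl
enumerate-small (suc f) {M} {s} M≤s = if-yes (M ≤? s) M≤s

enumerate-fuel : ∀ f g M s → M ∸ s ≤ f → M ∸ s ≤ g → enumerate f M s ≡ enumerate g M s
enumerate-fuel zero    g       M s hf hg = sym (enumerate-small g (fuel-zero hf))
enumerate-fuel (suc f) zero    M s hf hg = enumerate-small (suc f) (fuel-zero hg)
enumerate-fuel (suc f) (suc g) M s hf hg = cong (if_then_else_ (does (M ≤? s)) (onlyEmpty M)) (cong₂ _++_
  (enumerate-fuel f g M (suc s) (fuel-larger M s hf) (fuel-larger M s hg))
  (cong (map (snoc (suc s))) (enumerate-fuel f g (M ∸ suc s) (suc s) (fuel-remainder M s hf) (fuel-remainder M s hg))))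

distinctAbove : ℕ → ℕ → List (List ℕ)
distinctAbove M s = enumerate M M s

distinctAbove-small : ∀ {M s} → M ≤ s → distinctAbove M s ≡ onlyEmpty M
distinctAbove-small {M} = enumerate-small M

distinctAbove-split : ∀ {M s} → ¬ M ≤ s
  → distinctAbove M s ≡ distinctAbove M (suc s) ++ map (snoc (suc s)) (distinctAbove (M ∸ suc s) (suc s))
distinctAbove-split {zero}   {s} M≰s = ⊥-elim (M≰s z≤n)
distinctAbove-split {suc M′} {s} M≰s = trans (if-no (suc M′ ≤? s) M≰s) (cong₂ _++_
  (enumerate-fuel M′ (suc M′) (suc M′) (suc s) (fuel-larger (suc M′) s (ℕ.m∸n≤m (suc M′) s)) (ℕ.m∸n≤m (suc M′) (suc s)))
  (cong (map (snoc (suc s))) (enumerate-fuel M′ (suc M′ ∸ suc s) (suc M′ ∸ suc s) (suc s)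
                                 (fuel-remainder (suc M′) s (ℕ.m∸n≤m (suc M′) s)) (ℕ.m∸n≤m _ (suc s)))))

linked-snoc : ∀ {ρ y} → Linked ℕ._>_ ρ → All (y <_) ρ → Linked ℕ._>_ (snoc y ρ)
linked-snoc {[]}         _        _              = [-]
linked-snoc {x ∷ []}     _        (y<x ∷ [])     = y<x ∷ [-]
linked-snoc {x ∷ _ ∷ _}  (x>x′ ∷ l) (_ ∷ ys<)    = x>x′ ∷ linked-snoc l ys<

linked-cons : ∀ {x ρ} → All (ℕ._< x) ρ → Linked ℕ._>_ ρ → Linked ℕ._>_ (x ∷ ρ)
linked-cons {ρ = []}    _         _ = [-]
linked-cons {ρ = _ ∷ _} (y<x ∷ _) l = y<x ∷ l

linked-head : ∀ {x ρ} → Linked ℕ._>_ (x ∷ ρ) → All (ℕ._< x) ρ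
linked-head [-]       = []
linked-head (x>y ∷ l) = LinkedP.Linked⇒All (λ p q → ℕ.<-trans q p) x>y l

sum-snoc : ∀ ρ y → sum (snoc y ρ) ≡ sum ρ + y
sum-snoc ρ y = trans (ListActionP.sum-++ ρ (y ∷ [])) (cong (λ t → sum ρ + t) (ℕ.+-identityʳ y))

All-weaken : ∀ {s π} → All (suc s <_) π → All (s <_) π
All-weaken = All.map (ℕ.<-trans (ℕ.n<1+n _))

split-smallest : ∀ s π → Linked ℕ._>_ π → All (s <_) π →
  All (suc s <_) π ⊎ ∃[ ρ ] (π ≡ snoc (suc s) ρ × All (suc s <_) ρ × Linked ℕ._>_ ρ)
split-smallest s []       _ _ = inj₁ []
split-smallest s (x ∷ xs) l (s<x ∷ s<xs) with split-smallest s xs (Linked.tail l) s<xs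
... | inj₂ (ρ , refl , ρ>s+1 , lρ) = inj₂ (x ∷ ρ , refl , x>s+1 ∷ ρ>s+1 , linked-cons (AllP.++⁻ˡ ρ below-x) lρ)
  where
  below-x : All (ℕ._< x) (snoc (suc s) ρ)
  below-x = linked-head l
  x>s+1 : suc s < x
  x>s+1 = All.lookup below-x (∈-++⁺ʳ ρ (here refl))
... | inj₁ xs>s+1 with suc s ℕ.<? x
...   | yes x>s+1 = inj₁ (x>s+1 ∷ xs>s+1)
...   | no  x≯s+1 = inj₂ ([] , cong₂ _∷_ x≡s+1 xs≡[] , [] , [])
  where
  x≡s+1 : x ≡ suc s
  x≡s+1 = ℕ.≤-antisym (ℕ.≮⇒≥ x≯s+1) s<x
  squeezed : ∀ {ys} → All (ℕ._< x) ys → All (suc s <_) ys → ys ≡ []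
  squeezed []              []             = refl
  squeezed {y ∷ _} (y<x ∷ _) (s+1<y ∷ _) = ⊥-elim (ℕ.<-asym (subst (y <_) x≡s+1 y<x) s+1<y)
  xs≡[] : xs ≡ []
  xs≡[] = squeezed (linked-head l) xs>s+1

IsDistinctAbove-snoc : ∀ {s M ρ} → ¬ M ≤ s → IsDistinctAbove (suc s) (M ∸ suc s) ρ → IsDistinctAbove s M (snoc (suc s) ρ)
IsDistinctAbove-snoc {s} {M} {ρ} M≰s (l , ρ>s+1 , Σρ) =
  linked-snoc l ρ>s+1 , AllP.++⁺ (All-weaken ρ>s+1) (ℕ.n<1+n s ∷ []) ,
  trans (sum-snoc ρ (suc s)) (trans (cong (_+ suc s) Σρ) (ℕ.m∸n+n≡m (ℕ.≰⇒> M≰s)))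

IsDistinctAbove-unsnoc : ∀ {s M ρ} → All (suc s <_) ρ → Linked ℕ._>_ ρ → sum (snoc (suc s) ρ) ≡ M
  → IsDistinctAbove (suc s) (M ∸ suc s) ρ
IsDistinctAbove-unsnoc {s} {M} {ρ} ρ>s+1 l Σ≡M =
  l , ρ>s+1 , trans (sym (ℕ.m+n∸n≡m (sum ρ) (suc s))) (cong (_∸ suc s) (trans (sym (sum-snoc ρ (suc s))) Σ≡M))

onlyEmpty-complete : ∀ {s M π} → M ≤ s → IsDistinctAbove s M π → π ∈ onlyEmpty M
onlyEmpty-complete {π = []}    _   (_ , _ , refl)     = here refl
onlyEmpty-complete {π = x ∷ xs} M≤s (_ , s<x ∷ _ , Σ≡M) =
  ⊥-elim (ℕ.<⇒≱ s<x (ℕ.≤-trans (ℕ.m≤m+n x (sum xs)) (ℕ.≤-trans (ℕ.≤-reflexive Σ≡M) M≤s)))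

onlyEmpty-sound : ∀ {s M π} → π ∈ onlyEmpty M → IsDistinctAbove s M π
onlyEmpty-sound {M = zero} (here refl) = [] , [] , refl

distinctAbove-sound′ : ∀ k M s → M ∸ s ≤ k → ∀ {π} → π ∈ distinctAbove M s → IsDistinctAbove s M π
distinctAbove-sound′ k M s _ {π} π∈ with M ≤? s
... | yes M≤s = onlyEmpty-sound (subst (π ∈_) (distinctAbove-small M≤s) π∈)
distinctAbove-sound′ zero    M s bound π∈ | no M≰s = ⊥-elim (M≰s (fuel-zero bound))
distinctAbove-sound′ (suc k) M s bound {π} π∈ | no M≰s with ∈-++⁻ (distinctAbove M (suc s)) (subst (π ∈_) (distinctAbove-split M≰s) π∈)
... | inj₁ π∈larger = let (l , π>s+1 , Σπ) = distinctAbove-sound′ k M (suc s) (fuel-larger M s bound) π∈larger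
                       in l , All-weaken π>s+1 , Σπ
... | inj₂ π∈snocs with ∈-map⁻ (snoc (suc s)) π∈snocs
...   | ρ , ρ∈ , refl = IsDistinctAbove-snoc M≰s (distinctAbove-sound′ k (M ∸ suc s) (suc s) (fuel-remainder M s bound) ρ∈)

distinctAbove-complete′ : ∀ k M s → M ∸ s ≤ k → ∀ {π} → IsDistinctAbove s M π → π ∈ distinctAbove M s
distinctAbove-complete′ k M s _ {π} d with M ≤? s
... | yes M≤s = subst (π ∈_) (sym (distinctAbove-small M≤s)) (onlyEmpty-complete M≤s d)
distinctAbove-complete′ zero    M s bound d | no M≰s = ⊥-elim (M≰s (fuel-zero bound))
distinctAbove-complete′ (suc k) M s bound {π} (l , π>s , Σπ) | no M≰s
  rewrite distinctAbove-split {M} {s} M≰s with split-smallest s π l π>s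
... | inj₁ π>s+1 = ∈-++⁺ˡ (distinctAbove-complete′ k M (suc s) (fuel-larger M s bound) (l , π>s+1 , Σπ))
... | inj₂ (ρ , refl , ρ>s+1 , lρ) = ∈-++⁺ʳ (distinctAbove M (suc s)) (∈-map⁺ (snoc (suc s))
        (distinctAbove-complete′ k (M ∸ suc s) (suc s) (fuel-remainder M s bound) (IsDistinctAbove-unsnoc ρ>s+1 lρ Σπ)))

distinctAbove-unique′ : ∀ k M s → M ∸ s ≤ k → Unique (distinctAbove M s)
distinctAbove-unique′ k M s _ with M ≤? s
... | yes M≤s = subst Unique (sym (distinctAbove-small M≤s)) (onlyEmpty-unique M)
  where
  onlyEmpty-unique : ∀ M → Unique (onlyEmpty M)
  onlyEmpty-unique zero    = [] ∷ []
  onlyEmpty-unique (suc M) = []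
distinctAbove-unique′ zero    M s bound | no M≰s = ⊥-elim (M≰s (fuel-zero bound))
distinctAbove-unique′ (suc k) M s bound | no M≰s = subst Unique (sym (distinctAbove-split M≰s))
  (UniqueP.++⁺ (distinctAbove-unique′ k M (suc s) (fuel-larger M s bound))
               (UniqueP.map⁺ (ListP.++-cancelʳ (suc s ∷ []) _ _) (distinctAbove-unique′ k (M ∸ suc s) (suc s) (fuel-remainder M s bound)))
               disjoint)
  where
  disjoint : ∀ {π} → ¬ (π ∈ distinctAbove M (suc s) × π ∈ map (snoc (suc s)) (distinctAbove (M ∸ suc s) (suc s)))
  disjoint (π∈larger , π∈snocs) with ∈-map⁻ (snoc (suc s)) π∈snocs
  ... | ρ , _ , refl = ℕ.<-irrefl refl
        (All.lookup (proj₁ (proj₂ (distinctAbove-sound′ k M (suc s) (fuel-larger M s bound) π∈larger))) (∈-++⁺ʳ ρ (here refl)))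

distinctAbove-sound : ∀ {M s π} → π ∈ distinctAbove M s → IsDistinctAbove s M π
distinctAbove-sound {M} {s} = distinctAbove-sound′ M M s (ℕ.m∸n≤m M s)

distinctAbove-complete : ∀ {M s π} → IsDistinctAbove s M π → π ∈ distinctAbove M s
distinctAbove-complete {M} {s} = distinctAbove-complete′ M M s (ℕ.m∸n≤m M s)

distinctAbove-⇔ : ∀ {M s π} → (π ∈ distinctAbove M s) ⇔ IsDistinctAbove s M π
distinctAbove-⇔ = mk⇔ distinctAbove-sound distinctAbove-complete

distinctAbove-unique : ∀ M s → Unique (distinctAbove M s)
distinctAbove-unique M s = distinctAbove-unique′ M M s (ℕ.m∸n≤m M s)

isEmpty : List ℕ → ℤ
isEmpty []      = 1ℤ
isEmpty (_ ∷ _) = 0ℤ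

rankSign : List ℕ → ℤ
rankSign π = negOnePow (rank π)

negOnePow≡-1^ : ∀ z → negOnePow z ≡ -1^ ℤ.∣ z ∣
negOnePow≡-1^ z = if-2∣ ℤ.∣ z ∣

negOnePow-pred : ∀ z → negOnePow (z - 1ℤ) ≡ -ᶻ negOnePow z
negOnePow-pred z = trans (negOnePow≡-1^ (z - 1ℤ)) (trans (flip z) (cong -ᶻ_ (sym (negOnePow≡-1^ z))))
  where
  flip : ∀ z → -1^ ℤ.∣ z - 1ℤ ∣ ≡ -ᶻ -1^ ℤ.∣ z ∣
  flip (+ zero)    = refl
  flip (+ suc n)   = sym (ℤ.neg-involutive (-1^ n))
  flip -[1+ n ]    = cong (λ k → -ᶻ -ᶻ -1^ k) (ℕ.+-identityʳ n)

negOnePow-pred₂ : ∀ z → negOnePow (z - 1ℤ - 1ℤ) ≡ negOnePow z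
negOnePow-pred₂ z = trans (negOnePow-pred (z - 1ℤ)) (trans (cong -ᶻ_ (negOnePow-pred z)) (ℤ.neg-involutive _))

smallest-snoc : ∀ ρ y → smallest (snoc y ρ) ≡ y
smallest-snoc []           y = refl
smallest-snoc (_ ∷ [])     y = refl
smallest-snoc (_ ∷ x ∷ xs) y = smallest-snoc (x ∷ xs) y

rank-snoc : ∀ x xs y → rank (snoc y (x ∷ xs)) ≡ rank (x ∷ xs) - 1ℤ
rank-snoc x xs y = begin
  + x - + length (x ∷ xs ++ y ∷ [])      ≡⟨ cong (λ l → + x - + suc l) (ListP.length-++ xs) ⟩
  + x - + (suc (length xs) + 1)          ≡⟨ cong (λ w → + x - w) (sym (ℤ.pos-+ (suc (length xs)) 1)) ⟩
  + x - (+ suc (length xs) +ᶻ 1ℤ)        ≡⟨ regroup (+ x) (+ suc (length xs)) ⟩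
  + x - + suc (length xs) - 1ℤ           ∎
  where
  open ≡-Reasoning
  regroup : ∀ a l → a - (l +ᶻ 1ℤ) ≡ a - l - 1ℤ
  regroup = solve-∀

rankSign-snoc : ∀ ρ s → rankSign (snoc (suc s) ρ) ≡ -ᶻ rankSign ρ +ᶻ isEmpty ρ *ᶻ (-1^ s +ᶻ 1ℤ)
rankSign-snoc []       s = trans (if-2∣ s) (singleton (-1^ s))
  where
  singleton : ∀ x → x ≡ -ᶻ 1ℤ +ᶻ 1ℤ *ᶻ (x +ᶻ 1ℤ)
  singleton = solve-∀
rankSign-snoc (x ∷ xs) s = begin
  negOnePow (rank (snoc (suc s) (x ∷ xs)))      ≡⟨ cong negOnePow (rank-snoc x xs (suc s)) ⟩
  negOnePow (rank (x ∷ xs) - 1ℤ)                ≡⟨ negOnePow-pred (rank (x ∷ xs)) ⟩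
  -ᶻ rankSign (x ∷ xs)                          ≡⟨ sym (ℤ.+-identityʳ _) ⟩
  -ᶻ rankSign (x ∷ xs) +ᶻ 0ℤ                    ≡⟨ cong (-ᶻ rankSign (x ∷ xs) +ᶻ_) (sym (ℤ.*-zeroˡ (-1^ s +ᶻ 1ℤ))) ⟩
  -ᶻ rankSign (x ∷ xs) +ᶻ 0ℤ *ᶻ (-1^ s +ᶻ 1ℤ)    ∎
  where open ≡-Reasoning

weight-snoc : ∀ ρ y → weight (snoc y ρ) ≡ (if does (2 ∣? y) then 0ℤ else rankSign ρ - + 2 *ᶻ isEmpty ρ)
weight-snoc ρ y = trans (cong (λ t → if does (2 ∣? t) then 0ℤ else negOnePow (rank (snoc y ρ) - 1ℤ)) (smallest-snoc ρ y))
                         (by-parity (2 ∣? y))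
  where
  by-parity : (d : Dec (2 ∣ y)) → (if does d then 0ℤ else negOnePow (rank (snoc y ρ) - 1ℤ))
                                 ≡ (if does d then 0ℤ else rankSign ρ - + 2 *ᶻ isEmpty ρ)
  by-parity (yes _)  = refl
  by-parity (no 2∤y) = odd ρ
    where
    odd : ∀ ρ → negOnePow (rank (snoc y ρ) - 1ℤ) ≡ rankSign ρ - + 2 *ᶻ isEmpty ρ
    odd []       = trans (negOnePow-pred₂ (+ y)) (trans (negOnePow≡-1^ (+ y)) (-1^-odd 2∤y))
    odd (x ∷ xs) = trans (cong (λ r → negOnePow (r - 1ℤ)) (rank-snoc x xs y))
                         (trans (negOnePow-pred₂ (rank (x ∷ xs))) (sym (ℤ.+-identityʳ _)))

partitionSum : (List ℕ → ℤ) → ℕ → ℕ → ℤ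
partitionSum f M s = sumℤ (map f (distinctAbove M s))

partitionSum-small : ∀ f {M s} → M ≤ s → partitionSum f M s ≡ sumℤ (map f (onlyEmpty M))
partitionSum-small f M≤s = cong (sumℤ ∘ map f) (distinctAbove-small M≤s)

partitionSum-split : ∀ f {M s} → ¬ M ≤ s
  → partitionSum f M s ≡ partitionSum f M (suc s) +ᶻ sumℤ (map (f ∘ snoc (suc s)) (distinctAbove (M ∸ suc s) (suc s)))
partitionSum-split f {M} {s} M≰s = begin
  partitionSum f M s
      ≡⟨ cong (sumℤ ∘ map f) (distinctAbove-split M≰s) ⟩
  sumℤ (map f (distinctAbove M (suc s) ++ map (snoc (suc s)) (distinctAbove (M ∸ suc s) (suc s))))
      ≡⟨ sumℤ-map-++ f (distinctAbove M (suc s)) _ ⟩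
  partitionSum f M (suc s) +ᶻ sumℤ (map f (map (snoc (suc s)) (distinctAbove (M ∸ suc s) (suc s))))
      ≡⟨ cong (λ xs → partitionSum f M (suc s) +ᶻ sumℤ xs) (sym (ListP.map-∘ (distinctAbove (M ∸ suc s) (suc s)))) ⟩
  partitionSum f M (suc s) +ᶻ sumℤ (map (f ∘ snoc (suc s)) (distinctAbove (M ∸ suc s) (suc s))) ∎
  where open ≡-Reasoning

emptyCount : ∀ M s → partitionSum isEmpty M s ≡ one M
emptyCount M s = go M M s (ℕ.m∸n≤m M s)
  where
  go : ∀ k M s → M ∸ s ≤ k → partitionSum isEmpty M s ≡ one M
  go k M s bound with M ≤? s
  ... | yes M≤s = trans (partitionSum-small isEmpty M≤s) (onlyEmpty-count M)
    where
    onlyEmpty-count : ∀ M → sumℤ (map isEmpty (onlyEmpty M)) ≡ one M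
    onlyEmpty-count zero    = refl
    onlyEmpty-count (suc M) = refl
  go zero    M s bound | no M≰s = ⊥-elim (M≰s (fuel-zero bound))
  go (suc k) M s bound | no M≰s = begin
    partitionSum isEmpty M s                                                   ≡⟨ partitionSum-split isEmpty M≰s ⟩
    partitionSum isEmpty M (suc s) +ᶻ sumℤ (map (isEmpty ∘ snoc (suc s)) ρs)   ≡⟨ cong₂ _+ᶻ_ (go k M (suc s) (fuel-larger M s bound))
                                                                                              (sumℤ-map-zero ρs isEmpty-snoc) ⟩
    one M +ᶻ 0ℤ                                                                ≡⟨ ℤ.+-identityʳ (one M) ⟩
    one M                                                                      ∎
    where
    open ≡-Reasoning
    ρs = distinctAbove (M ∸ suc s) (suc s)
    isEmpty-snoc : ∀ ρ → isEmpty (snoc (suc s) ρ) ≡ 0ℤ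
    isEmpty-snoc []      = refl
    isEmpty-snoc (_ ∷ _) = refl

rankSum : ℕ → ℕ → ℤ
rankSum = partitionSum rankSign

rankSum-small : ∀ {M s} → M ≤ s → rankSum M s ≡ one M
rankSum-small {M} M≤s = trans (partitionSum-small rankSign M≤s) (onlyEmpty-rank M)
  where
  onlyEmpty-rank : ∀ M → sumℤ (map rankSign (onlyEmpty M)) ≡ one M
  onlyEmpty-rank zero    = refl
  onlyEmpty-rank (suc M) = refl

rankSum-split : ∀ {M s} → ¬ M ≤ s
  → rankSum M s ≡ rankSum M (suc s) - rankSum (M ∸ suc s) (suc s) +ᶻ one (M ∸ suc s) *ᶻ (-1^ s +ᶻ 1ℤ)
rankSum-split {M} {s} M≰s = begin
  rankSum M s                                                   ≡⟨ partitionSum-split rankSign M≰s ⟩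
  rankSum M (suc s) +ᶻ sumℤ (map (rankSign ∘ snoc (suc s)) ρs)  ≡⟨ cong (rankSum M (suc s) +ᶻ_) appended ⟩
  rankSum M (suc s) +ᶻ (-1ℤ *ᶻ rankSum M′ (suc s) +ᶻ c *ᶻ one M′) ≡⟨ regroup (rankSum M (suc s)) (rankSum M′ (suc s)) (one M′) c ⟩
  rankSum M (suc s) - rankSum M′ (suc s) +ᶻ one M′ *ᶻ c          ∎
  where
  open ≡-Reasoning
  M′ = M ∸ suc s
  ρs = distinctAbove M′ (suc s)
  c = -1^ s +ᶻ 1ℤ
  appended : sumℤ (map (rankSign ∘ snoc (suc s)) ρs) ≡ -1ℤ *ᶻ rankSum M′ (suc s) +ᶻ c *ᶻ one M′
  appended = begin
    sumℤ (map (rankSign ∘ snoc (suc s)) ρs)                         ≡⟨ sumℤ-map-cong ρs (λ ρ → trans (rankSign-snoc ρ s) (linear (rankSign ρ) (isEmpty ρ) c)) ⟩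
    sumℤ (map (λ ρ → -1ℤ *ᶻ rankSign ρ +ᶻ c *ᶻ isEmpty ρ) ρs)         ≡⟨ sumℤ-map-linear rankSign isEmpty -1ℤ c ρs ⟩
    -1ℤ *ᶻ rankSum M′ (suc s) +ᶻ c *ᶻ partitionSum isEmpty M′ (suc s) ≡⟨ cong (λ x → -1ℤ *ᶻ rankSum M′ (suc s) +ᶻ c *ᶻ x) (emptyCount M′ (suc s)) ⟩
    -1ℤ *ᶻ rankSum M′ (suc s) +ᶻ c *ᶻ one M′                         ∎
    where
    linear : ∀ a e c → -ᶻ a +ᶻ e *ᶻ c ≡ -1ℤ *ᶻ a +ᶻ c *ᶻ e
    linear = solve-∀
  regroup : ∀ r b e c → r +ᶻ (-1ℤ *ᶻ b +ᶻ c *ᶻ e) ≡ r - b +ᶻ e *ᶻ c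
  regroup = solve-∀

rankSlice : ℕ → PS
rankSlice j M = -1^ j *ᶻ (rankSum M j - one M)

rankSlice-vanishing : Vanishing rankSlice
rankSlice-vanishing j M M≤j = begin
  -1^ j *ᶻ (rankSum M j - one M)   ≡⟨ cong (λ x → -1^ j *ᶻ (x - one M)) (rankSum-small M≤j) ⟩
  -1^ j *ᶻ (one M - one M)         ≡⟨ cong (-1^ j *ᶻ_) (ℤ.+-inverseʳ (one M)) ⟩
  -1^ j *ᶻ 0ℤ                      ≡⟨ ℤ.*-zeroʳ (-1^ j) ⟩
  0ℤ                               ∎
  where open ≡-Reasoning

rankSlice-functionalEquation : FunctionalEquation rankSlice
rankSlice-functionalEquation j M with M ≤? j
... | yes M≤j = trans (cong₂ _+ᶻ_ (rankSlice-vanishing j M M≤j) (rankSlice-vanishing (suc j) M (ℕ.m≤n⇒m≤1+n M≤j)))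
                      (sym (shift-< (suc j) (λ K → one K +ᶻ rankSlice (suc j) K) (s≤s M≤j)))
... | no M≰j with ℕ.m≤n⇒∃[o]m+o≡n (ℕ.≰⇒> M≰j)
...   | M′ , refl = begin
  s *ᶻ (rankSum M j - 0ℤ) +ᶻ -ᶻ s *ᶻ (rankSum M (suc j) - 0ℤ)
      ≡⟨ cong (λ x → s *ᶻ (x - 0ℤ) +ᶻ -ᶻ s *ᶻ (rankSum M (suc j) - 0ℤ)) (rankSum-split M≰j) ⟩
  s *ᶻ (rankSum M (suc j) - rankSum (M ∸ suc j) (suc j) +ᶻ one (M ∸ suc j) *ᶻ (s +ᶻ 1ℤ) - 0ℤ) +ᶻ -ᶻ s *ᶻ (rankSum M (suc j) - 0ℤ)
      ≡⟨ cong (λ K → s *ᶻ (rankSum M (suc j) - rankSum K (suc j) +ᶻ one K *ᶻ (s +ᶻ 1ℤ) - 0ℤ) +ᶻ -ᶻ s *ᶻ (rankSum M (suc j) - 0ℤ))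
              (ℕ.m+n∸m≡n (suc j) M′) ⟩
  s *ᶻ (rankSum M (suc j) - b +ᶻ e *ᶻ (s +ᶻ 1ℤ) - 0ℤ) +ᶻ -ᶻ s *ᶻ (rankSum M (suc j) - 0ℤ)
      ≡⟨ expand s (rankSum M (suc j)) b e ⟩
  e *ᶻ (s *ᶻ s) +ᶻ s *ᶻ e - s *ᶻ b
      ≡⟨ cong (λ x → e *ᶻ x +ᶻ s *ᶻ e - s *ᶻ b) (-1^-square j) ⟩
  e *ᶻ 1ℤ +ᶻ s *ᶻ e - s *ᶻ b
      ≡⟨ collect s b e ⟩
  e +ᶻ -ᶻ s *ᶻ (b - e)
      ≡⟨ sym (shift-+ (suc j) (λ K → one K +ᶻ rankSlice (suc j) K) M′) ⟩
  shift (suc j) (λ K → one K +ᶻ rankSlice (suc j) K) M ∎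
  where
  open ≡-Reasoning
  s = -1^ j
  b = rankSum M′ (suc j)
  e = one M′
  expand : ∀ s r b e → s *ᶻ (r - b +ᶻ e *ᶻ (s +ᶻ 1ℤ) - 0ℤ) +ᶻ -ᶻ s *ᶻ (r - 0ℤ) ≡ e *ᶻ (s *ᶻ s) +ᶻ s *ᶻ e - s *ᶻ b
  expand = solve-∀
  collect : ∀ s b e → e *ᶻ 1ℤ +ᶻ s *ᶻ e - s *ᶻ b ≡ e +ᶻ -ᶻ s *ᶻ (b - e)
  collect = solve-∀

weightSum : ℕ → ℕ → ℤ
weightSum = partitionSum weight

weightSum-small : ∀ {M s} → M ≤ s → weightSum M s ≡ 0ℤ
weightSum-small {M} M≤s = trans (partitionSum-small weight M≤s) (onlyEmpty-weight M)
  where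
  onlyEmpty-weight : ∀ M → sumℤ (map weight (onlyEmpty M)) ≡ 0ℤ
  onlyEmpty-weight zero    = refl
  onlyEmpty-weight (suc M) = refl

weightSum-even : ∀ M {s} → 2 ∣ suc s → weightSum M s ≡ weightSum M (suc s)
weightSum-even M {s} 2∣1+s with M ≤? s
... | yes M≤s = trans (weightSum-small M≤s) (sym (weightSum-small (ℕ.m≤n⇒m≤1+n M≤s)))
... | no  M≰s = begin
  weightSum M s                                                        ≡⟨ partitionSum-split weight M≰s ⟩
  weightSum M (suc s) +ᶻ sumℤ (map (weight ∘ snoc (suc s)) ρs)         ≡⟨ cong (weightSum M (suc s) +ᶻ_) (sumℤ-map-zero ρs appended) ⟩
  weightSum M (suc s) +ᶻ 0ℤ                                            ≡⟨ ℤ.+-identityʳ _ ⟩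
  weightSum M (suc s)                                                  ∎
  where
  open ≡-Reasoning
  ρs = distinctAbove (M ∸ suc s) (suc s)
  appended : ∀ ρ → weight (snoc (suc s) ρ) ≡ 0ℤ
  appended ρ = trans (weight-snoc ρ (suc s)) (if-yes (2 ∣? suc s) 2∣1+s)

weightSum-odd : ∀ {M s} → ¬ M ≤ s → ¬ 2 ∣ suc s
  → weightSum M s ≡ weightSum M (suc s) +ᶻ (rankSum (M ∸ suc s) (suc s) - + 2 *ᶻ one (M ∸ suc s))
weightSum-odd {M} {s} M≰s 2∤1+s = begin
  weightSum M s                                                              ≡⟨ partitionSum-split weight M≰s ⟩
  weightSum M (suc s) +ᶻ sumℤ (map (weight ∘ snoc (suc s)) ρs)               ≡⟨ cong (weightSum M (suc s) +ᶻ_) appended ⟩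
  weightSum M (suc s) +ᶻ (rankSum M′ (suc s) - + 2 *ᶻ one M′)                 ∎
  where
  open ≡-Reasoning
  M′ = M ∸ suc s
  ρs = distinctAbove M′ (suc s)
  appended : sumℤ (map (weight ∘ snoc (suc s)) ρs) ≡ rankSum M′ (suc s) - + 2 *ᶻ one M′
  appended = begin
    sumℤ (map (weight ∘ snoc (suc s)) ρs)                                  ≡⟨ sumℤ-map-cong ρs (λ ρ → trans (weight-snoc ρ (suc s))
                                                                                  (trans (if-no (2 ∣? suc s) 2∤1+s) (linear (rankSign ρ) (isEmpty ρ)))) ⟩
    sumℤ (map (λ ρ → 1ℤ *ᶻ rankSign ρ +ᶻ -ᶻ + 2 *ᶻ isEmpty ρ) ρs)           ≡⟨ sumℤ-map-linear rankSign isEmpty 1ℤ (-ᶻ + 2) ρs ⟩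
    1ℤ *ᶻ rankSum M′ (suc s) +ᶻ -ᶻ + 2 *ᶻ partitionSum isEmpty M′ (suc s)   ≡⟨ cong (λ x → 1ℤ *ᶻ rankSum M′ (suc s) +ᶻ -ᶻ + 2 *ᶻ x) (emptyCount M′ (suc s)) ⟩
    1ℤ *ᶻ rankSum M′ (suc s) +ᶻ -ᶻ + 2 *ᶻ one M′                           ≡⟨ sym (linear (rankSum M′ (suc s)) (one M′)) ⟩
    rankSum M′ (suc s) - + 2 *ᶻ one M′                                     ∎
    where
    linear : ∀ r e → r - + 2 *ᶻ e ≡ 1ℤ *ᶻ r +ᶻ -ᶻ + 2 *ᶻ e
    linear = solve-∀

weightSum-pair : ∀ N {s} → 2 ∣ s → weightSum N s - weightSum N (2 + s) ≡ -ᶻ rankSlice s N +ᶻ -ᶻ rankSlice (suc s) N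
weightSum-pair N {s} 2∣s with N ≤? s
... | yes N≤s = begin
  weightSum N s - weightSum N (2 + s)                  ≡⟨ cong₂ _-_ (weightSum-small N≤s) (weightSum-small (ℕ.≤-trans N≤s (ℕ.m≤n+m s 2))) ⟩
  0ℤ                                                   ≡⟨ sym (cong₂ (λ x y → -ᶻ x +ᶻ -ᶻ y) (rankSlice-vanishing s N N≤s)
                                                                   (rankSlice-vanishing (suc s) N (ℕ.m≤n⇒m≤1+n N≤s))) ⟩
  -ᶻ rankSlice s N +ᶻ -ᶻ rankSlice (suc s) N           ∎
  where open ≡-Reasoning
... | no N≰s = begin
  weightSum N s - weightSum N (2 + s)
      ≡⟨ cong₂ _-_ (weightSum-odd N≰s (2∣n⇒2∤1+n 2∣s)) (sym (weightSum-even N (Div.∣m∣n⇒∣m+n (Div.∣-refl {2}) 2∣s))) ⟩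
  weightSum N (suc s) +ᶻ (b - + 2 *ᶻ e) - weightSum N (suc s)
      ≡⟨ cancel (weightSum N (suc s)) (b - + 2 *ᶻ e) ⟩
  b - + 2 *ᶻ e
      ≡⟨ sym (negate e b) ⟩
  -ᶻ (e +ᶻ -1ℤ *ᶻ (b - e))
      ≡⟨ cong (λ x → -ᶻ (e +ᶻ x *ᶻ (b - e))) (sym (cong -ᶻ_ (-1^-even 2∣s))) ⟩
  -ᶻ (e +ᶻ rankSlice (suc s) N′)
      ≡⟨ cong -ᶻ_ (sym (shift-≥ (suc s) (λ K → one K +ᶻ rankSlice (suc s) K) (ℕ.≰⇒> N≰s))) ⟩
  -ᶻ shift (suc s) (λ K → one K +ᶻ rankSlice (suc s) K) N
      ≡⟨ cong -ᶻ_ (sym (rankSlice-functionalEquation s N)) ⟩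
  -ᶻ (rankSlice s N +ᶻ rankSlice (suc s) N)
      ≡⟨ ℤ.neg-distrib-+ (rankSlice s N) (rankSlice (suc s) N) ⟩
  -ᶻ rankSlice s N +ᶻ -ᶻ rankSlice (suc s) N ∎
  where
  open ≡-Reasoning
  N′ = N ∸ suc s
  b = rankSum N′ (suc s)
  e = one N′
  cancel : ∀ w x → w +ᶻ x - w ≡ x
  cancel = solve-∀
  negate : ∀ e b → -ᶻ (e +ᶻ -1ℤ *ᶻ (b - e)) ≡ b - + 2 *ᶻ e
  negate = solve-∀

weightSum-rankSlices : ∀ N → weightSum N 0 ≡ -ᶻ Σ< (suc N) (λ j → rankSlice j N)
weightSum-rankSlices N = begin
  weightSum N 0                                          ≡⟨ sym (ℤ.+-identityʳ _) ⟩
  weightSum N 0 - 0ℤ                                     ≡⟨ cong (weightSum N 0 -_) (sym (weightSum-small (ℕ.m≤m+n N (N + 0)))) ⟩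
  weightSum N 0 - weightSum N (2 * N)                    ≡⟨ telescope-pairs N (weightSum N) (λ j → -ᶻ rankSlice j N) (λ t → weightSum-pair N (Div.m∣m*n t)) ⟩
  Σ< (2 * N) (λ j → -ᶻ rankSlice j N)                    ≡⟨ Σ<-neg (2 * N) (λ j → rankSlice j N) ⟩
  -ᶻ Σ< (2 * N) (λ j → rankSlice j N)                    ≡⟨ cong -ᶻ_ (trans (Σ<-truncate N (2 * N) (λ j → rankSlice-vanishing j N) (ℕ.m≤m+n N (N + 0)))
                                                                            (sym (Σ<-truncate N (suc N) (λ j → rankSlice-vanishing j N) (ℕ.n≤1+n N)))) ⟩
  -ᶻ Σ< (suc N) (λ j → rankSlice j N)                    ∎
  where
  open ≡-Reasoning

divisorCount : ∀ {P : ℕ → Set} (P? : ∀ d → Dec (P d)) N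
  → + length (filter P? (divisors N)) ≡ Σ< N (λ n → when (suc n ∣? N) (when (P? (suc n)) 1ℤ))
divisorCount P? N = begin
  + length (filter P? (divisors N))                                        ≡⟨ length≡sumℤ (filter P? (divisors N)) ⟩
  sumℤ (map (λ _ → 1ℤ) (filter P? (divisors N)))                            ≡⟨ sumℤ-map-filter P? (λ _ → 1ℤ) (divisors N) ⟩
  sumℤ (map (λ d → when (P? d) 1ℤ) (filter (_∣? N) (map suc (upTo N))))     ≡⟨ sumℤ-map-filter (_∣? N) _ (map suc (upTo N)) ⟩
  sumℤ (map (λ d → when (d ∣? N) (when (P? d) 1ℤ)) (map suc (upTo N)))      ≡⟨ cong sumℤ (sym (ListP.map-∘ (upTo N))) ⟩
  sumℤ (map (λ n → when (suc n ∣? N) (when (P? (suc n)) 1ℤ)) (upTo N))      ≡⟨ sumℤ-map-applyUpTo N _ (λ i → i) ⟩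
  Σ< N (λ n → when (suc n ∣? N) (when (P? (suc n)) 1ℤ))                     ∎
  where open ≡-Reasoning

Σ<-factorisations : ∀ n N → n < N → ∀ c → Σ< N (λ k → when (suc n * suc k ≟ N) c) ≡ when (suc n ∣? N) c
Σ<-factorisations n N n<N c with suc n ∣? N
... | no n+1∤N = trans (Σ<-zero N (λ k _ → if-no (suc n * suc k ≟ N)
                               (λ e → n+1∤N (Div.divides (suc k) (trans (sym e) (ℕ.*-comm (suc n) (suc k)))))))
                       (sym (if-no (suc n ∣? N) n+1∤N))
... | yes (Div.divides zero    N≡0) = ⊥-elim (ℕ.<⇒≢ (ℕ.≤-<-trans z≤n n<N) (sym N≡0))
... | yes n+1∣N@(Div.divides (suc k) N≡k+1*n+1) =
  trans (Σ<-single N k k<N others) (trans (if-yes (suc n * suc k ≟ N) k+1*n+1≡N) (sym (if-yes (suc n ∣? N) n+1∣N)))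
  where
  k+1*n+1≡N : suc n * suc k ≡ N
  k+1*n+1≡N = trans (ℕ.*-comm (suc n) (suc k)) (sym N≡k+1*n+1)
  k<N : k < N
  k<N = subst (k <_) (sym N≡k+1*n+1) (ℕ.≤-trans (ℕ.n<1+n k) (ℕ.m≤m*n (suc k) (suc n)))
  others : ∀ i → i < N → i ≢ k → when (suc n * suc i ≟ N) c ≡ 0ℤ
  others i _ i≢k = if-no (suc n * suc i ≟ N)
    (λ e → i≢k (ℕ.suc-injective (ℕ.*-cancelˡ-≡ (suc i) (suc k) (suc n) (trans e (sym k+1*n+1≡N)))))

even-minus-odd : ∀ n → when (2 ∣? suc n) 1ℤ - when (¬? (2 ∣? suc n)) 1ℤ ≡ -1^ (suc n)
even-minus-odd n = trans (by-cases (2 ∣? suc n)) (if-2∣ (suc n))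
  where
  by-cases : ∀ {P : Set} (d : Dec P) → when d 1ℤ - when (¬? d) 1ℤ ≡ (if does d then 1ℤ else -1ℤ)
  by-cases (yes _) = refl
  by-cases (no  _) = refl

divisors-even-minus-odd : ∀ N → + dₑ N - + dₒ N ≡ -ᶻ factorSum (λ i k → -1^ i) N
divisors-even-minus-odd N = begin
  + dₑ N - + dₒ N
      ≡⟨ cong₂ _-_ (divisorCount (2 ∣?_) N) (divisorCount (λ d → ¬? (2 ∣? d)) N) ⟩
  Σ< N (λ n → when (suc n ∣? N) (when (2 ∣? suc n) 1ℤ)) - Σ< N (λ n → when (suc n ∣? N) (when (¬? (2 ∣? suc n)) 1ℤ))
      ≡⟨ sym (Σ<-- N _ _) ⟩
  Σ< N (λ n → when (suc n ∣? N) (when (2 ∣? suc n) 1ℤ) - when (suc n ∣? N) (when (¬? (2 ∣? suc n)) 1ℤ))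
      ≡⟨ Σ<-ext N (λ n → trans (when-- (suc n ∣? N) _ _) (cong (when (suc n ∣? N)) (even-minus-odd n))) ⟩
  Σ< N (λ n → when (suc n ∣? N) (-ᶻ -1^ n))
      ≡⟨ Σ<-ext N (λ n → when-neg (suc n ∣? N) (-1^ n)) ⟩
  Σ< N (λ n → -ᶻ when (suc n ∣? N) (-1^ n))
      ≡⟨ Σ<-neg N _ ⟩
  -ᶻ Σ< N (λ n → when (suc n ∣? N) (-1^ n))
      ≡⟨ cong -ᶻ_ (sym (Σ<-cong N (λ n n<N → Σ<-factorisations n N n<N (-1^ n)))) ⟩
  -ᶻ factorSum (λ i k → -1^ i) N ∎
  where
  open ≡-Reasoning
  when-- : ∀ {P : Set} (d : Dec P) x y → when d x - when d y ≡ when d (x - y)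
  when-- (yes _) x y = refl
  when-- (no  _) x y = refl
  when-neg : ∀ {P : Set} (d : Dec P) x → when d (-ᶻ x) ≡ -ᶻ when d x
  when-neg (yes _) x = refl
  when-neg (no  _) x = refl


-- The three solutions of the functional equation coincide

lhsSlice≡pochSlice : ∀ j N → lhsSlice j N ≡ pochSlice j N
lhsSlice≡pochSlice = functionalEquation-unique lhsSlice-functionalEquation lhsSlice-vanishing
                                               pochSlice-functionalEquation pochSlice-vanishing

rankSlice≡pochSlice : ∀ j N → rankSlice j N ≡ pochSlice j N
rankSlice≡pochSlice = functionalEquation-unique rankSlice-functionalEquation rankSlice-vanishing
                                                pochSlice-functionalEquation pochSlice-vanishing

corollary5p7 : ((N : ℕ) → seriesCoeff lhsTerm N ≡ seriesCoeff rhsTerm N)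
    × ((n : ℕ) → 1 ≤ n → (L : List (List ℕ)) → Unique L
       → ((π : List ℕ) → (π ∈ L) ⇔ IsDistinctPartition n π)
       → sumℤ (map weight L) ≡ (+ dₑ n) - (+ dₒ n))
corollary5p7 = lhs≡rhs , weightedCount
  where
  open ≡-Reasoning
  lhs≡rhs : ∀ N → seriesCoeff lhsTerm N ≡ seriesCoeff rhsTerm N
  lhs≡rhs N = begin
    seriesCoeff lhsTerm N              ≡⟨ lhs-slices N ⟩
    Σ< (suc N) (λ j → lhsSlice j N)    ≡⟨ Σ<-ext (suc N) (λ j → lhsSlice≡pochSlice j N) ⟩
    Σ< (suc N) (λ j → pochSlice j N)   ≡⟨ pochSlices-factorSum N ⟩
    factorSum (λ i k → -1^ i) N        ≡⟨ factorSum-transpose (λ i k → -1^ i) N ⟩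
    factorSum (λ i k → -1^ k) N        ≡⟨ sym (rhs-factorSum N) ⟩
    seriesCoeff rhsTerm N              ∎
  weightedCount : ∀ n → 1 ≤ n → (L : List (List ℕ)) → Unique L → ((π : List ℕ) → (π ∈ L) ⇔ IsDistinctPartition n π)
    → sumℤ (map weight L) ≡ + dₑ n - + dₒ n
  weightedCount n _ L unique-L members = begin
    sumℤ (map weight L)                         ≡⟨ sumℤ-map-sameMembers weight unique-L (distinctAbove-unique n 0)
                                                     (λ {π} → ⇔.trans (members π) (⇔.sym distinctAbove-⇔)) ⟩
    weightSum n 0                               ≡⟨ weightSum-rankSlices n ⟩
    -ᶻ Σ< (suc n) (λ j → rankSlice j n)         ≡⟨ cong -ᶻ_ (Σ<-ext (suc n) (λ j → rankSlice≡pochSlice j n)) ⟩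
    -ᶻ Σ< (suc n) (λ j → pochSlice j n)         ≡⟨ cong -ᶻ_ (pochSlices-factorSum n) ⟩
    -ᶻ factorSum (λ i k → -1^ i) n              ≡⟨ sym (divisors-even-minus-odd n) ⟩
    + dₑ n - + dₒ n                             ∎
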